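{- Let $C$ be a reachable command, $(s,h)\in\mathcal{S}$, $\Gamma$ a resource context, $\rho=(O,L,D)$ a resource configuration, $Q,R$ assertions and $A,X\subseteq\mathbf{Var}$. Suppose $r\notin\rho$, $\Gamma'=\Gamma,r(X):R$ is a resource context and $FV(Q)\subseteq A$. Then: (1) If $r\in Locked(C)$ and $\mathit{Safe}_n(C,s,h,(O\cup\{r\},L,D),\Gamma',Q,A)$ holds, then $\mathit{Safe}_n(\mathsf{resource}\ r\ \mathsf{in}\ C,s,h,\rho,\Gamma,Q\ast R,A\cup X)$ holds. (2) If $r\notin Locked(C)$, there exists a heap $h_R$ with $h_R\bot h$ and $s,h_R\models R$, and $\mathit{Safe}_n(C,s,h,(O,L,D\cup\{r\}),\Gamma',Q,A)$ holds, then $\mathit{Safe}_n(\mathsf{resource}\ r\ \mathsf{in}\ C,s,h\uplus h_R,\rho,\Gamma,Q\ast R,A\cup X)$ holds.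
   Context: Stores $s:\mathbf{Var}\to\mathbf{Val}$; finite partial heaps; $\mathcal{S}$ pairs $(s,h)$; separation-logic assertions with standard satisfaction and free variables $FV$; $h\bot g$ disjoint domains, $h\uplus g$ union. A resource context is a list $r_1(X_1):R_1,\dots,r_n(X_n):R_n$ (distinct resource names, $X_i\subseteq\mathbf{Var}$, precise $R_i$ with $FV(R_i)\subseteq X_i$); $\Gamma,r(X):R$ its extension; $PV(r_i)=X_i$, $\Gamma(r_i)=R_i$, $\circledast_{r\in D}\Gamma(r)$ separating conjunction over $D$ ($\texttt{emp}$ if empty). Resource configuration: triple $(O,L,D)$ of pairwise disjoint sets of resource names; $r\in\rho$ iff $r\in O\cup L\cup D$; $\rho\setminus\{r\}$ componentwise removal. Commands: $\mathsf{skip}$, basic commands $x:=e$, $x:=[e]$, $[e]:=e'$, $x:=\mathsf{cons}(\dots)$, $\mathsf{dispose}(e)$ (standard semantics $[c](s,h)$, pair or $\mathsf{abort}$), $C_1;C_2$, $\mathsf{if}$, $\mathsf{while}$, $\mathsf{resource}\ r\ \mathsf{in}\ C$, $\mathsf{with}\ r\ \mathsf{when}\ B\ \mathsf{do}\ C$, $C_1\|C_2$ (unextended), and $\mathsf{within}\ r\ \mathsf{do}\ C$. $Locked(C_1;C_2)=Locked(C_1)$, $Locked(C_1\|C_2)=Locked(C_1)\cup Locked(C_2)$, $Locked(\mathsf{resource}\ r\ \mathsf{in}\ C)=Locked(C)\setminus\{r\}$, $Locked(\mathsf{within}\ r\ \mathsf{do}\ C)=Locked(C)\cup\{r\}$,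 else $\emptyset$. Program transitions $\to_p$: (S1) $\mathsf{skip};C_2\to C_2$; (S2) $C_1;C_2$ steps via $C_1$; (LP) while unfolds to $\mathsf{if}\ B\ \mathsf{then}\ (C;\mathsf{while}\ B\ \mathsf{do}\ C)\ \mathsf{else}\ \mathsf{skip}$; (IF1/IF2) by $s(B)$; (P1/P2) a parallel component steps; (P3) $\mathsf{skip}\|\mathsf{skip}\to\mathsf{skip}$; (R0) $\mathsf{resource}\ r\ \mathsf{in}\ \mathsf{skip},(s,h,\rho)\to_p\mathsf{skip},(s,h,\rho)$ if $r\notin\rho$; (R1) if $r\notin\rho=(O,L,D)$, $r\in Locked(C)$, $C,(s,h,(O\cup\{r\},L,D))\to_pC',(s',h',\rho')$ then $\mathsf{resource}\ r\ \mathsf{in}\ C,(s,h,\rho)\to_p\mathsf{resource}\ r\ \mathsf{in}\ C',(s',h',\rho'\setminus\{r\})$; (R2) same with $r\notin Locked(C)$ and $(O,L,D\cup\{r\})$; (W0) $\mathsf{with}\ r\ \mathsf{when}\ B\ \mathsf{do}\ C,(s,h,(O,L,D\cup\{r\}))\to_p\mathsf{within}\ r\ \mathsf{do}\ C,(s,h,(O\cup\{r\},L,D))$ if $s(B)=\texttt{true}$; (W1) if $r\in O$ and $C,(s,h,(O\setminus\{r\},L,D))\to_pC',(s',h',(O',L',D'))$ then $\mathsf{within}\ r\ \mathsf{do}\ C,(s,h,(O,L,D))\to_p\mathsf{within}\ r\ \mathsf{do}\ C',(s',h',(O'\cup\{r\},L',D'))$; (W2) $\mathsf{within}\ r\ \mathsf{do}\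 \mathsf{skip},(s,h,(O\cup\{r\},L,D))\to_p\mathsf{skip},(s,h,(O,L,D\cup\{r\}))$; (BCT) $c,(s,h,\rho)\to_p\mathsf{skip},(s',h',\rho)$ if $[c](s,h)=(s',h')$. Abort: (RA) $\mathsf{resource}\ r$ with $r\in\rho$; (WA) $\mathsf{with}\ r$ with $r\notin\rho$; (RA1)/(RA2) body aborts under the configurations of (R1)/(R2); (BCA) $[c](s,h)=\mathsf{abort}$; (SA) first component of $;$ aborts; (WA1) body of $\mathsf{within}\ r$ aborts under $\rho\setminus\{r\}$; (WA2) $\mathsf{within}\ r$ with $r\notin O$; (PA1/PA2) a component of $\|$ aborts. A command is reachable if for some unextended $C_0$ there are states $\sigma,\sigma'$ and $k$ with $C_0,\sigma\to_p^kC',\sigma'$ and $C_0,\sigma\not\to_p^j\mathsf{abort}$ for $j\le k$. Environment: $(s,h,(O,L,D))\stackrel{A}{\leftrightsquigarrow}(s',h,(O,L',D'))$ iff $s(x)=s'(x)$ for $x\in A$ and $L'\cup D'=L\cup D$; with $A'=A\cup\bigcup_{r\in Locked(C)}PV(r)$, if $(s,h,\rho)\stackrel{A'}{\leftrightsquigarrow}(s',h,\rho')$, $\rho=(O,L,D)$, $\rho'=(O,L',D')$, $s,h_G\models\circledast_{r\in D}\Gamma(r)$, $s',h'_G\models\circledast_{r\in D'}\Gamma(r)$, then $C,(s,h\uplus h_G,\rho)\xrightarrow{A,\Gamma}_eC,(s',h\uplus h'_G,\rho')$; $\xrightarrow{A,\Gamma}=\to_p\cup\xrightarrow{A,\Gamma}_e$.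 $chng(C)$: variables $x$ such that the next transition of $C$ can execute $x:=e$, $x:=[e]$ or $x:=\mathsf{cons}(\dots)$. Safety: $\mathit{Safe}_0$ always holds; $\mathit{Safe}_{n+1}(C,s,h,\rho,\Gamma,Q,A)$, $\rho=(O,L,D)$, iff (i) $C=\mathsf{skip}\Rightarrow s,h\models Q$; (ii) $C,(s,h,\rho)\not\to_p\mathsf{abort}$; (iii) $chng(C)\cap\bigcup_{r\in L\cup D}PV(r)=\emptyset$; (iv) for every $h_G\bot h$ with $s,h_G\models\circledast_{r\in D}\Gamma(r)$ and every $C,(s,h\uplus h_G,\rho)\xrightarrow{A,\Gamma}C',(s',\hat h,\rho')$, $\rho'=(O',L',D')$, there exist $h',h'_G$ with $\hat h=h'\uplus h'_G$, $s',h'_G\models\circledast_{r\in D'}\Gamma(r)$ and $\mathit{Safe}_n(C',s',h',\rho',\Gamma,Q,A)$. -}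

module Defs where

open import Level using (0ℓ; Lift)
open import Data.Nat as ℕ using (ℕ; zero; suc; _≤_)
open import Data.Integer as ℤ using (ℤ; +_)
open import Data.Bool using (Bool; true; false; if_then_else_; _∧_; _∨_; not)
open import Data.Maybe using (Maybe; just; nothing)
open import Data.List using (List; []; _∷_; _++_; [_]; map; length)
open import Data.List.Membership.Propositional using (_∈_)
open import Data.List.Relation.Unary.Any using (here; there)
open import Data.List.Membership.Propositional.Properties using (∈-++⁺ˡ; ∈-++⁺ʳ)
open import Data.List.Relation.Unary.Unique.Propositional using (Unique)
open import Data.Product using (Σ; _×_; _,_; ∃)
open import Data.Sum using (_⊎_)
open import Data.Empty using (⊥)
open import Data.Unit.Polymorphic using (⊤)
open import Relation.Nullary using (¬_; does; yes; no)
open import Relation.Unary using (Pred; _∪_; ｛_｝)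
open import Relation.Binary.PropositionalEquality using (_≡_; _≢_; refl; sym; trans)
open import Function using (_⇔_)

Var : Set
Var = ℕ

Val : Set
Val = ℤ

RName : Set
RName = ℕ

Store : Set
Store = Var → Val

upd : Store → Var → Val → Store
upd s x v y = if does (y ℕ.≟ x) then v else s y

VarSet : Set₁
VarSet = Pred Var 0ℓ

RSet : Set₁
RSet = Pred RName 0ℓ

-- Finite partial heaps  (locations are values)

record Heap : Set where
  field
    at  : Val → Maybe Val
    dom : List Val
    fin : ∀ l v → at l ≡ just v → l ∈ dom
open Heap public

emptyH : Heap
emptyH = record { at = λ _ → nothing ; dom = [] ; fin = λ { l v () } }

_⊥h_ : Heap → Heap → Set
h ⊥h g = ∀ l → at h l ≡ nothing ⊎ at g l ≡ nothing

_≐_ : Heap → Heap → Set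
h ≐ g = ∀ l → at h l ≡ at g l

_⊑_ : Heap → Heap → Set
h ⊑ g = ∀ l v → at h l ≡ just v → at g l ≡ just v

IsEmpty : Heap → Set
IsEmpty h = ∀ l → at h l ≡ nothing

private
  unionAt : Maybe Val → Maybe Val → Maybe Val
  unionAt (just v) _ = just v
  unionAt nothing  m = m

  unionFin : (h g : Heap) → ∀ l v → unionAt (at h l) (at g l) ≡ just v →
             l ∈ (dom h ++ dom g)
  unionFin h g l v e with at h l in eh
  ... | just w  = ∈-++⁺ˡ (fin h l w eh)
  ... | nothing = ∈-++⁺ʳ (dom h) (fin g l v e)

-- h ⊎ g (union; only meaningful, and only used, when h ⊥h g)
_⊎h_ : Heap → Heap → Heap
h ⊎h g = record
  { at  = λ l → unionAt (at h l) (at g l)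
  ; dom = dom h ++ dom g
  ; fin = unionFin h g }

private
  updFin : (h : Heap) (l : Val) (v : Val) → ∀ l' w →
           (if does (l' ℤ.≟ l) then just v else at h l') ≡ just w → l' ∈ (l ∷ dom h)
  updFin h l v l' w e with l' ℤ.≟ l
  ... | yes refl = here refl
  ... | no _     = there (fin h l' w e)

  remFin : (h : Heap) (l : Val) → ∀ l' w →
           (if does (l' ℤ.≟ l) then nothing else at h l') ≡ just w → l' ∈ dom h
  remFin h l l' w e with l' ℤ.≟ l
  ... | yes refl with e
  ...   | ()
  remFin h l l' w e | no _ = fin h l' w e

updH : Heap → Val → Val → Heap
updH h l v = record
  { at  = λ l' → if does (l' ℤ.≟ l) then just v else at h l'
  ; dom = l ∷ dom h
  ; fin = updFin h l v }

remH : Heap → Val → Heap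
remH h l = record
  { at  = λ l' → if does (l' ℤ.≟ l) then nothing else at h l'
  ; dom = dom h
  ; fin = remFin h l }

allocH : Val → List Val → Heap → Heap
allocH l []       h = h
allocH l (v ∷ vs) h = updH (allocH (l ℤ.+ ℤ.1ℤ) vs h) l v

data Exp : Set where
  var  : Var → Exp
  lit  : Val → Exp
  _⊕_  : Exp → Exp → Exp
  _⊖_  : Exp → Exp → Exp
  _⊗_  : Exp → Exp → Exp

⟦_⟧ : Exp → Store → Val
⟦ var x ⟧ s = s x
⟦ lit v ⟧ s = v
⟦ e ⊕ f ⟧ s = ⟦ e ⟧ s ℤ.+ ⟦ f ⟧ s
⟦ e ⊖ f ⟧ s = ⟦ e ⟧ s ℤ.- ⟦ f ⟧ s
⟦ e ⊗ f ⟧ s = ⟦ e ⟧ s ℤ.* ⟦ f ⟧ s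

data BExp : Set where
  btrue bfalse : BExp
  _≐e_ _≤e_    : Exp → Exp → BExp
  bnot         : BExp → BExp
  _band_ _bor_ : BExp → BExp → BExp

⟦_⟧b : BExp → Store → Bool
⟦ btrue ⟧b s = true
⟦ bfalse ⟧b s = false
⟦ e ≐e f ⟧b s = does (⟦ e ⟧ s ℤ.≟ ⟦ f ⟧ s)
⟦ e ≤e f ⟧b s = does (⟦ e ⟧ s ℤ.≤? ⟦ f ⟧ s)
⟦ bnot b ⟧b s = not (⟦ b ⟧b s)
⟦ b band c ⟧b s = ⟦ b ⟧b s ∧ ⟦ c ⟧b s
⟦ b bor c ⟧b s = ⟦ b ⟧b s ∨ ⟦ c ⟧b s

FVe : Exp → VarSet
FVe (var x) y = y ≡ x
FVe (lit v) y = ⊥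
FVe (e ⊕ f) y = FVe e y ⊎ FVe f y
FVe (e ⊖ f) y = FVe e y ⊎ FVe f y
FVe (e ⊗ f) y = FVe e y ⊎ FVe f y

FVb : BExp → VarSet
FVb btrue y = ⊥
FVb bfalse y = ⊥
FVb (e ≐e f) y = FVe e y ⊎ FVe f y
FVb (e ≤e f) y = FVe e y ⊎ FVe f y
FVb (bnot b) y = FVb b y
FVb (b band c) y = FVb b y ⊎ FVb c y
FVb (b bor c) y = FVb b y ⊎ FVb c y

data Assn : Set where
  pure      : BExp → Assn
  emp       : Assn
  _↦_       : Exp → Exp → Assn
  _∗_       : Assn → Assn → Assn
  _-∗_      : Assn → Assn → Assn
  _∧a_      : Assn → Assn → Assn
  _∨a_      : Assn → Assn → Assn
  _⇒a_      : Assn → Assn → Assn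
  ¬a_       : Assn → Assn
  ∀a        : Var → Assn → Assn
  ∃a        : Var → Assn → Assn

_,_⊨_ : Store → Heap → Assn → Set
s , h ⊨ pure b = ⟦ b ⟧b s ≡ true
s , h ⊨ emp = IsEmpty h
s , h ⊨ (e ↦ f) = at h (⟦ e ⟧ s) ≡ just (⟦ f ⟧ s) × (∀ l → l ≢ ⟦ e ⟧ s → at h l ≡ nothing)
s , h ⊨ (P ∗ Q) = Σ Heap λ h₁ → Σ Heap λ h₂ →
  h₁ ⊥h h₂ × h ≐ (h₁ ⊎h h₂) × s , h₁ ⊨ P × s , h₂ ⊨ Q
s , h ⊨ (P -∗ Q) = ∀ h' → h' ⊥h h → s , h' ⊨ P → s , (h ⊎h h') ⊨ Q
s , h ⊨ (P ∧a Q) = s , h ⊨ P × s , h ⊨ Q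
s , h ⊨ (P ∨a Q) = s , h ⊨ P ⊎ s , h ⊨ Q
s , h ⊨ (P ⇒a Q) = s , h ⊨ P → s , h ⊨ Q
s , h ⊨ (¬a P) = ¬ (s , h ⊨ P)
s , h ⊨ ∀a x P = ∀ v → (upd s x v) , h ⊨ P
s , h ⊨ ∃a x P = Σ Val λ v → (upd s x v) , h ⊨ P

FV : Assn → VarSet
FV (pure b) y = FVb b y
FV emp y = ⊥
FV (e ↦ f) y = FVe e y ⊎ FVe f y
FV (P ∗ Q) y = FV P y ⊎ FV Q y
FV (P -∗ Q) y = FV P y ⊎ FV Q y
FV (P ∧a Q) y = FV P y ⊎ FV Q y
FV (P ∨a Q) y = FV P y ⊎ FV Q y
FV (P ⇒a Q) y = FV P y ⊎ FV Q y
FV (¬a P) y = FV P y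
FV (∀a x P) y = FV P y × y ≢ x
FV (∃a x P) y = FV P y × y ≢ x

Precise : Assn → Set
Precise R = ∀ s h h₁ h₂ → h₁ ⊑ h → h₂ ⊑ h → s , h₁ ⊨ R → s , h₂ ⊨ R → h₁ ≐ h₂

record Entry : Set₁ where
  constructor _⦅_⦆∶_
  field
    name : RName
    vars : VarSet
    inv  : Assn
open Entry public

Ctx : Set₁
Ctx = List Entry

_,,_⦅_⦆∶_ : Ctx → RName → VarSet → Assn → Ctx
Γ ,, r ⦅ X ⦆∶ R = Γ ++ [ r ⦅ X ⦆∶ R ]

IsResourceContext : Ctx → Set₁
IsResourceContext Γ =
  Unique (map name Γ) ×
  (∀ e → e ∈ Γ → Precise (inv e) × (∀ y → FV (inv e) y → vars e y))

PVover : Ctx → RSet → VarSet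
PVover [] D x = ⊥
PVover (e ∷ Γ) D x = (D (name e) × vars e x) ⊎ PVover Γ D x

Sat⊛ : Store → Heap → Ctx → RSet → Set
Sat⊛ s h [] D = IsEmpty h
Sat⊛ s h (e ∷ Γ) D = Σ Heap λ h₁ → Σ Heap λ h₂ →
  h₁ ⊥h h₂ × h ≐ (h₁ ⊎h h₂) ×
  ((D (name e) × s , h₁ ⊨ inv e) ⊎ (¬ D (name e) × IsEmpty h₁)) ×
  Sat⊛ s h₂ Γ D

record Config : Set₁ where
  constructor cfg
  field
    O L D : RSet
open Config public

IsConfig : Config → Set
IsConfig (cfg O L D) = ∀ r → ¬ (O r × L r) × ¬ (O r × D r) × ¬ (L r × D r)

_∈ρ_ : RName → Config → Set
r ∈ρ (cfg O L D) = O r ⊎ L r ⊎ D r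

_－_ : RSet → RName → RSet
(X － r) x = X x × x ≢ r

_∖ρ_ : Config → RName → Config
(cfg O L D) ∖ρ r = cfg (O － r) (L － r) (D － r)

data BCmd : Set where
  _≔_      : Var → Exp → BCmd
  _≔[_]    : Var → Exp → BCmd
  [_]≔_    : Exp → Exp → BCmd
  _≔cons_  : Var → List Exp → BCmd
  dispose  : Exp → BCmd

data Cmd : Set where
  skip     : Cmd
  basic    : BCmd → Cmd
  _⨾_      : Cmd → Cmd → Cmd
  IF_THEN_ELSE_ : BExp → Cmd → Cmd → Cmd
  WHILE_DO_ : BExp → Cmd → Cmd
  RESOURCE_IN_ : RName → Cmd → Cmd
  WITH_WHEN_DO_ : RName → BExp → Cmd → Cmd
  _∥_      : Cmd → Cmd → Cmd
  WITHIN_DO_ : RName → Cmd → Cmd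

Locked : Cmd → RSet
Locked (C₁ ⨾ C₂) = Locked C₁
Locked (C₁ ∥ C₂) = Locked C₁ ∪ Locked C₂
Locked (RESOURCE r IN C) x = Locked C x × x ≢ r
Locked (WITHIN r DO C) = Locked C ∪ ｛ r ｝
Locked _ x = ⊥

Unextended : Cmd → Set
Unextended skip = ⊤
Unextended (basic c) = ⊤
Unextended (C₁ ⨾ C₂) = Unextended C₁ × Unextended C₂
Unextended (IF B THEN C₁ ELSE C₂) = Unextended C₁ × Unextended C₂
Unextended (WHILE B DO C) = Unextended C
Unextended (RESOURCE r IN C) = Unextended C
Unextended (WITH r WHEN B DO C) = Unextended C
Unextended (C₁ ∥ C₂) = Unextended C₁ × Unextended C₂
Unextended (WITHIN r DO C) = ⊥

-- chng(C): variables that the next transition of C can assign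
chngB : BCmd → VarSet
chngB (x ≔ e) y = y ≡ x
chngB (x ≔[ e ]) y = y ≡ x
chngB (x ≔cons es) y = y ≡ x
chngB _ y = ⊥

chng : Cmd → VarSet
chng (basic c) = chngB c
chng (C₁ ⨾ C₂) = chng C₁
chng (C₁ ∥ C₂) = chng C₁ ∪ chng C₂
chng (RESOURCE r IN C) = chng C
chng (WITHIN r DO C) = chng C
chng _ y = ⊥

FreeBlock : Heap → Val → ℕ → Set
FreeBlock h l zero = ⊤
FreeBlock h l (suc n) = at h l ≡ nothing × FreeBlock h (l ℤ.+ ℤ.1ℤ) n

data BOk : BCmd → Store → Heap → Store → Heap → Set where
  assign : ∀ {x e s h} → BOk (x ≔ e) s h (upd s x (⟦ e ⟧ s)) h
  load   : ∀ {x e s h v} → at h (⟦ e ⟧ s) ≡ just v → BOk (x ≔[ e ]) s h (upd s x v) h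
  store  : ∀ {e f s h v} → at h (⟦ e ⟧ s) ≡ just v →
           BOk ([ e ]≔ f) s h s (updH h (⟦ e ⟧ s) (⟦ f ⟧ s))
  cons   : ∀ {x es s h} l → FreeBlock h l (length es) →
           BOk (x ≔cons es) s h (upd s x l) (allocH l (map (λ e → ⟦ e ⟧ s) es) h)
  disp   : ∀ {e s h v} → at h (⟦ e ⟧ s) ≡ just v → BOk (dispose e) s h s (remH h (⟦ e ⟧ s))

data BAbort : BCmd → Store → Heap → Set where
  load-abort  : ∀ {x e s h} → at h (⟦ e ⟧ s) ≡ nothing → BAbort (x ≔[ e ]) s h
  store-abort : ∀ {e f s h} → at h (⟦ e ⟧ s) ≡ nothing → BAbort ([ e ]≔ f) s h
  disp-abort  : ∀ {e s h} → at h (⟦ e ⟧ s) ≡ nothing → BAbort (dispose e) s h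

record State : Set₁ where
  constructor ⟨_,_,_⟩
  field
    sto : Store
    hp  : Heap
    rc  : Config

data _,_⟶p_,_ : Cmd → State → Cmd → State → Set₁ where
  S1  : ∀ {C₂ σ} → (skip ⨾ C₂) , σ ⟶p C₂ , σ
  S2  : ∀ {C₁ C₁' C₂ σ σ'} → C₁ , σ ⟶p C₁' , σ' → (C₁ ⨾ C₂) , σ ⟶p (C₁' ⨾ C₂) , σ'
  LP  : ∀ {B C σ} → (WHILE B DO C) , σ ⟶p (IF B THEN (C ⨾ (WHILE B DO C)) ELSE skip) , σ
  IF1 : ∀ {B C₁ C₂ s h ρ} → ⟦ B ⟧b s ≡ true →
        (IF B THEN C₁ ELSE C₂) , ⟨ s , h , ρ ⟩ ⟶p C₁ , ⟨ s , h , ρ ⟩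
  IF2 : ∀ {B C₁ C₂ s h ρ} → ⟦ B ⟧b s ≡ false →
        (IF B THEN C₁ ELSE C₂) , ⟨ s , h , ρ ⟩ ⟶p C₂ , ⟨ s , h , ρ ⟩
  P1  : ∀ {C₁ C₁' C₂ σ σ'} → C₁ , σ ⟶p C₁' , σ' → (C₁ ∥ C₂) , σ ⟶p (C₁' ∥ C₂) , σ'
  P2  : ∀ {C₁ C₂ C₂' σ σ'} → C₂ , σ ⟶p C₂' , σ' → (C₁ ∥ C₂) , σ ⟶p (C₁ ∥ C₂') , σ'
  P3  : ∀ {σ} → (skip ∥ skip) , σ ⟶p skip , σ
  R0  : ∀ {r s h ρ} → ¬ (r ∈ρ ρ) → (RESOURCE r IN skip) , ⟨ s , h , ρ ⟩ ⟶p skip , ⟨ s , h , ρ ⟩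
  R1  : ∀ {r C C' s h O L D s' h' ρ'} → ¬ (r ∈ρ cfg O L D) → Locked C r →
        C , ⟨ s , h , cfg (O ∪ ｛ r ｝) L D ⟩ ⟶p C' , ⟨ s' , h' , ρ' ⟩ →
        (RESOURCE r IN C) , ⟨ s , h , cfg O L D ⟩ ⟶p (RESOURCE r IN C') , ⟨ s' , h' , ρ' ∖ρ r ⟩
  R2  : ∀ {r C C' s h O L D s' h' ρ'} → ¬ (r ∈ρ cfg O L D) → ¬ Locked C r →
        C , ⟨ s , h , cfg O L (D ∪ ｛ r ｝) ⟩ ⟶p C' , ⟨ s' , h' , ρ' ⟩ →
        (RESOURCE r IN C) , ⟨ s , h , cfg O L D ⟩ ⟶p (RESOURCE r IN C') , ⟨ s' , h' , ρ' ∖ρ r ⟩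
  -- (O, L, D ∪ {r}) → (O ∪ {r}, L, D): stated for a configuration whose D contains r
  W0  : ∀ {r B C s h O L D} → D r → ⟦ B ⟧b s ≡ true →
        (WITH r WHEN B DO C) , ⟨ s , h , cfg O L D ⟩ ⟶p
        (WITHIN r DO C) , ⟨ s , h , cfg (O ∪ ｛ r ｝) L (D － r) ⟩
  W1  : ∀ {r C C' s h O L D s' h' O' L' D'} → O r →
        C , ⟨ s , h , cfg (O － r) L D ⟩ ⟶p C' , ⟨ s' , h' , cfg O' L' D' ⟩ →
        (WITHIN r DO C) , ⟨ s , h , cfg O L D ⟩ ⟶p
        (WITHIN r DO C') , ⟨ s' , h' , cfg (O' ∪ ｛ r ｝) L' D' ⟩
  -- (O ∪ {r}, L, D) → (O, L, D ∪ {r}): stated for a configuration whose O contains r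
  W2  : ∀ {r s h O L D} → O r →
        (WITHIN r DO skip) , ⟨ s , h , cfg O L D ⟩ ⟶p
        skip , ⟨ s , h , cfg (O － r) L (D ∪ ｛ r ｝) ⟩
  BCT : ∀ {c s h ρ s' h'} → BOk c s h s' h' →
        basic c , ⟨ s , h , ρ ⟩ ⟶p skip , ⟨ s' , h' , ρ ⟩

data _,_⟶abort : Cmd → State → Set₁ where
  RA  : ∀ {r C s h ρ} → r ∈ρ ρ → (RESOURCE r IN C) , ⟨ s , h , ρ ⟩ ⟶abort
  WA  : ∀ {r B C s h ρ} → ¬ (r ∈ρ ρ) → (WITH r WHEN B DO C) , ⟨ s , h , ρ ⟩ ⟶abort
  RA1 : ∀ {r C s h O L D} → ¬ (r ∈ρ cfg O L D) → Locked C r →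
        C , ⟨ s , h , cfg (O ∪ ｛ r ｝) L D ⟩ ⟶abort →
        (RESOURCE r IN C) , ⟨ s , h , cfg O L D ⟩ ⟶abort
  RA2 : ∀ {r C s h O L D} → ¬ (r ∈ρ cfg O L D) → ¬ Locked C r →
        C , ⟨ s , h , cfg O L (D ∪ ｛ r ｝) ⟩ ⟶abort →
        (RESOURCE r IN C) , ⟨ s , h , cfg O L D ⟩ ⟶abort
  BCA : ∀ {c s h ρ} → BAbort c s h → basic c , ⟨ s , h , ρ ⟩ ⟶abort
  SA  : ∀ {C₁ C₂ σ} → C₁ , σ ⟶abort → (C₁ ⨾ C₂) , σ ⟶abort
  WA1 : ∀ {r C s h ρ} → C , ⟨ s , h , ρ ∖ρ r ⟩ ⟶abort → (WITHIN r DO C) , ⟨ s , h , ρ ⟩ ⟶abort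
  WA2 : ∀ {r C s h ρ} → ¬ O ρ r → (WITHIN r DO C) , ⟨ s , h , ρ ⟩ ⟶abort
  PA1 : ∀ {C₁ C₂ σ} → C₁ , σ ⟶abort → (C₁ ∥ C₂) , σ ⟶abort
  PA2 : ∀ {C₁ C₂ σ} → C₂ , σ ⟶abort → (C₁ ∥ C₂) , σ ⟶abort

data _,_⟶p[_]_,_ : Cmd → State → ℕ → Cmd → State → Set₁ where
  refl-step : ∀ {C σ} → C , σ ⟶p[ zero ] C , σ
  next-step : ∀ {C σ C' σ' C'' σ'' k} → C , σ ⟶p C' , σ' →
              C' , σ' ⟶p[ k ] C'' , σ'' → C , σ ⟶p[ suc k ] C'' , σ''

AbortsIn : ℕ → Cmd → State → Set₁
AbortsIn zero C σ = Lift _ ⊥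
AbortsIn (suc j) C σ =
  Σ Cmd λ C' → Σ State λ σ' → C , σ ⟶p[ j ] C' , σ' × C' , σ' ⟶abort

Reachable : Cmd → Set₁
Reachable C' = Σ Cmd λ C₀ → Unextended C₀ × Σ State λ σ → Σ State λ σ' → Σ ℕ λ k →
  IsConfig (State.rc σ) × C₀ , σ ⟶p[ k ] C' , σ' × (∀ j → j ≤ k → ¬ AbortsIn j C₀ σ)

data _,_⟶e[_,_]_,_ : Cmd → State → VarSet → Ctx → Cmd → State → Set₁ where
  env : ∀ {C A Γ s s' H H' h hG hG' O L D L' D'} →
        (∀ x → (A ∪ PVover Γ (Locked C)) x → s x ≡ s' x) →
        (∀ r → (L r ⊎ D r) ⇔ (L' r ⊎ D' r)) →
        IsConfig (cfg O L' D') →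
        h ⊥h hG → H ≐ (h ⊎h hG) → Sat⊛ s hG Γ D →
        h ⊥h hG' → H' ≐ (h ⊎h hG') → Sat⊛ s' hG' Γ D' →
        C , ⟨ s , H , cfg O L D ⟩ ⟶e[ A , Γ ] C , ⟨ s' , H' , cfg O L' D' ⟩

_,_⟶[_,_]_,_ : Cmd → State → VarSet → Ctx → Cmd → State → Set₁
C , σ ⟶[ A , Γ ] C' , σ' = C , σ ⟶p C' , σ' ⊎ C , σ ⟶e[ A , Γ ] C' , σ'

Safe : ℕ → Cmd → Store → Heap → Config → Ctx → Assn → VarSet → Set₁
Safe zero C s h ρ Γ Q A = ⊤
Safe (suc n) C s h ρ Γ Q A =
  (C ≡ skip → s , h ⊨ Q) ×
  ¬ (C , ⟨ s , h , ρ ⟩ ⟶abort) ×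
  (∀ x → chng C x → ¬ PVover Γ (L ρ ∪ D ρ) x) ×
  (∀ hG → h ⊥h hG → Sat⊛ s hG Γ (D ρ) →
    ∀ C' s' ĥ ρ' → C , ⟨ s , h ⊎h hG , ρ ⟩ ⟶[ A , Γ ] C' , ⟨ s' , ĥ , ρ' ⟩ →
    Σ Heap λ h' → Σ Heap λ hG' →
      h' ⊥h hG' × ĥ ≐ (h' ⊎h hG') × Sat⊛ s' hG' Γ (D ρ') ×
      Safe n C' s' h' ρ' Γ Q A)

-- Both parts are proved together by induction on n.  A step of 'resource r in C'
-- is either a step of C, taken in the configuration extended by r and in the
-- context extended by r(X):R, or an environment move, which lifts to an
-- environment move of C.  All invariants are precise, so a heap splits in at most
-- one way into a local part and a frame satisfying the invariants; hence an
-- environment move leaves the local heap unchanged.  After a step of C the frame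
-- part belonging to r is empty if C still holds r (part 1), and otherwise it
-- satisfies R and is handed to the local heap (part 2).

module Submission where

open import Defs
open import Data.Nat as ℕ using (ℕ; zero; suc)
import Data.Nat.Properties as ℕₚ
import Data.Integer as ℤ
open import Data.Bool using (true; false; T; not; _∧_; _∨_)
open import Data.Maybe using (Maybe; just; nothing)
open import Data.Product as Product using (Σ; _×_; _,_; proj₁; proj₂; map₁; map₂)
open import Data.Sum as Sum using (_⊎_; inj₁; inj₂; [_,_]′; swap)
open import Data.Empty using (⊥-elim)
open import Data.Unit.Polymorphic using (tt)
open import Data.List using (List; []; _∷_; _++_; [_]; map)
open import Data.List.Relation.Unary.All as All using (All; []; _∷_)
import Data.List.Relation.Unary.All.Properties as Allₚ
open import Data.List.Relation.Unary.AllPairs using ([]; _∷_)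
open import Data.List.Relation.Unary.Unique.Propositional using (Unique)
open import Data.List.Relation.Unary.Any using (here)
open import Data.List.Membership.Propositional.Properties using (∈-++⁺ʳ)
open import Function using (_∘_; _⇔_; mk⇔; Equivalence)
open import Relation.Nullary using (¬_; Dec; yes; no; does)
open import Relation.Unary using (_∪_; _⊆_; ｛_｝) renaming (_≐_ to _≋_)
import Relation.Unary.Properties as Setₚ
import Function.Properties.Equivalence as ⇔
open import Relation.Binary.Bundles using (Setoid)
import Relation.Binary.Reasoning.Setoid
open import Relation.Binary.PropositionalEquality
  using (_≡_; _≢_; refl; sym; trans; cong; cong₂; subst; _→-setoid_)

-- Heap algebra

module ≐ = Setoid (Val →-setoid Maybe Val)
module ≐-Reasoning = Relation.Binary.Reasoning.Setoid (Val →-setoid Maybe Val)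

⊎h-just : ∀ h g {l v} → at h l ≡ just v → at (h ⊎h g) l ≡ just v
⊎h-just h g e rewrite e = refl

⊎h-nothingˡ : ∀ h g {l} → at h l ≡ nothing → at (h ⊎h g) l ≡ at g l
⊎h-nothingˡ h g e rewrite e = refl

⊎h-nothingʳ : ∀ h g {l} → at g l ≡ nothing → at (h ⊎h g) l ≡ at h l
⊎h-nothingʳ h g {l} e with at h l
... | just v  = refl
... | nothing = e

⊎h-nothing⁻ : ∀ h g {l} → at (h ⊎h g) l ≡ nothing → at h l ≡ nothing × at g l ≡ nothing
⊎h-nothing⁻ h g {l} e with at h l
... | nothing = refl , e

⊎h-cong : ∀ h h' g g' → h ≐ h' → g ≐ g' → (h ⊎h g) ≐ (h' ⊎h g')
⊎h-cong h h' g g' e f l rewrite e l | f l = refl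

⊎h-comm : ∀ h g → h ⊥h g → (h ⊎h g) ≐ (g ⊎h h)
⊎h-comm h g d l with d l
... | inj₁ hl = trans (⊎h-nothingˡ h g hl) (sym (⊎h-nothingʳ g h hl))
... | inj₂ gl = trans (⊎h-nothingʳ h g gl) (sym (⊎h-nothingˡ g h gl))

⊎h-assoc : ∀ h g k → ((h ⊎h g) ⊎h k) ≐ (h ⊎h (g ⊎h k))
⊎h-assoc h g k l with at h l
... | just v  = refl
... | nothing = refl

⊎h-identityʳ : ∀ h e → IsEmpty e → (h ⊎h e) ≐ h
⊎h-identityʳ h e empty l = ⊎h-nothingʳ h e (empty l)

⊥h-sym : ∀ h g → h ⊥h g → g ⊥h h
⊥h-sym h g d l = swap (d l)

⊥h-respˡ-≐ : ∀ h h' g → h ≐ h' → h ⊥h g → h' ⊥h g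
⊥h-respˡ-≐ h h' g e d l = Sum.map₁ (trans (sym (e l))) (d l)

⊥h-respʳ-≐ : ∀ h g g' → g ≐ g' → h ⊥h g → h ⊥h g'
⊥h-respʳ-≐ h g g' e d l = Sum.map₂ (trans (sym (e l))) (d l)

⊥h-⊎ˡ⁻ : ∀ h g k → (h ⊎h g) ⊥h k → h ⊥h k × g ⊥h k
⊥h-⊎ˡ⁻ h g k d = (λ l → Sum.map₁ (proj₁ ∘ ⊎h-nothing⁻ h g) (d l))
               , (λ l → Sum.map₁ (proj₂ ∘ ⊎h-nothing⁻ h g) (d l))

⊥h-⊎ʳ⁻ : ∀ k h g → k ⊥h (h ⊎h g) → k ⊥h h × k ⊥h g
⊥h-⊎ʳ⁻ k h g d = (λ l → Sum.map₂ (proj₁ ∘ ⊎h-nothing⁻ h g) (d l))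
               , (λ l → Sum.map₂ (proj₂ ∘ ⊎h-nothing⁻ h g) (d l))

⊥h-⊎ˡ : ∀ h g k → h ⊥h k → g ⊥h k → (h ⊎h g) ⊥h k
⊥h-⊎ˡ h g k d e l with d l | e l
... | inj₂ kl | _       = inj₂ kl
... | inj₁ hl | inj₁ gl = inj₁ (trans (⊎h-nothingˡ h g hl) gl)
... | inj₁ _  | inj₂ kl = inj₂ kl

⊥h-⊎ʳ : ∀ k h g → k ⊥h h → k ⊥h g → k ⊥h (h ⊎h g)
⊥h-⊎ʳ k h g d e = ⊥h-sym (h ⊎h g) k (⊥h-⊎ˡ h g k (⊥h-sym k h d) (⊥h-sym k g e))

⊎h-substˡ : ∀ ĥ h h' g → h ≐ h' → h ⊥h g → ĥ ≐ (h ⊎h g) → h' ⊥h g × ĥ ≐ (h' ⊎h g)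
⊎h-substˡ ĥ h h' g e d q = ⊥h-respˡ-≐ h h' g e d , ≐.trans q (⊎h-cong h h' g g e ≐.refl)

⊥h-assoc : ∀ h g k → h ⊥h g → (h ⊎h g) ⊥h k → h ⊥h (g ⊎h k) × g ⊥h k
⊥h-assoc h g k h⊥g hg⊥k = ⊥h-⊎ʳ h g k h⊥g (proj₁ split) , proj₂ split
  where
  split : h ⊥h k × g ⊥h k
  split = ⊥h-⊎ˡ⁻ h g k hg⊥k

⊑-⊎ˡ : ∀ h g → h ⊑ (h ⊎h g)
⊑-⊎ˡ h g l v = ⊎h-just h g

⊑-⊎ʳ : ∀ h g → h ⊥h g → g ⊑ (h ⊎h g)
⊑-⊎ʳ h g d l v e with d l
... | inj₁ hl = trans (⊎h-nothingˡ h g hl) e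
... | inj₂ gl with trans (sym e) gl
...   | ()

⊑-respˡ-≐ : ∀ h h' g → h ≐ h' → h ⊑ g → h' ⊑ g
⊑-respˡ-≐ h h' g e s l v x = s l v (trans (e l) x)

⊑-respʳ-≐ : ∀ h g g' → g ≐ g' → h ⊑ g → h ⊑ g'
⊑-respʳ-≐ h g g' e s l v x = trans (sym (e l)) (s l v x)

⊎h-⊑⁻ : ∀ h g k → h ⊥h g → (h ⊎h g) ⊑ k → h ⊑ k × g ⊑ k
⊎h-⊑⁻ h g k d s = (λ l v → s l v ∘ ⊑-⊎ˡ h g l v) , (λ l v → s l v ∘ ⊑-⊎ʳ h g d l v)

⊑-nothing : ∀ h g {l} → h ⊑ g → at g l ≡ nothing → at h l ≡ nothing
⊑-nothing h g {l} s e with at h l in eh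
... | nothing = refl
... | just v with trans (sym (s l v eh)) e
...   | ()

⊎h-cancelʳ : ∀ h g h' g' → h ⊥h g → h' ⊥h g' → (h ⊎h g) ≐ (h' ⊎h g') → g ≐ g' → h ≐ h'
⊎h-cancelʳ h g h' g' d d' e f l with d l | d' l
... | inj₁ hl | inj₁ h'l = trans hl (sym h'l)
... | inj₂ gl | _ =
  trans (sym (⊎h-nothingʳ h g gl)) (trans (e l) (⊎h-nothingʳ h' g' (trans (sym (f l)) gl)))
... | _ | inj₂ g'l =
  trans (sym (⊎h-nothingʳ h g (trans (f l) g'l))) (trans (e l) (⊎h-nothingʳ h' g' g'l))

-- Coincidence

AgreeOn : VarSet → Store → Store → Set
AgreeOn V s s' = ∀ x → V x → s x ≡ s' x

agree-∪ˡ : ∀ {V W s s'} → AgreeOn (V ∪ W) s s' → AgreeOn V s s'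
agree-∪ˡ a x v = a x (inj₁ v)

agree-∪ʳ : ∀ {V W s s'} → AgreeOn (V ∪ W) s s' → AgreeOn W s s'
agree-∪ʳ a x w = a x (inj₂ w)

agree-sym : ∀ {V s s'} → AgreeOn V s s' → AgreeOn V s' s
agree-sym a x v = sym (a x v)

agree-upd : ∀ {V s s' x v} → AgreeOn (λ y → V y × y ≢ x) s s' → AgreeOn V (upd s x v) (upd s' x v)
-- upd tests 'does (y ≟ x)', which computes to y ≡ᵇ x.
agree-upd {x = x} a y p with y ℕ.≡ᵇ x in y≡ᵇx
... | true  = refl
... | false = a y (p , λ y≡x → subst T y≡ᵇx (ℕₚ.≡⇒≡ᵇ y x y≡x))

eval-agree : ∀ e {s s'} → AgreeOn (FVe e) s s' → ⟦ e ⟧ s ≡ ⟦ e ⟧ s'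
eval-agree (var x) a = a x refl
eval-agree (lit v) a = refl
eval-agree (e ⊕ f) a = cong₂ ℤ._+_ (eval-agree e (agree-∪ˡ a)) (eval-agree f (agree-∪ʳ a))
eval-agree (e ⊖ f) a = cong₂ ℤ._-_ (eval-agree e (agree-∪ˡ a)) (eval-agree f (agree-∪ʳ a))
eval-agree (e ⊗ f) a = cong₂ ℤ._*_ (eval-agree e (agree-∪ˡ a)) (eval-agree f (agree-∪ʳ a))

evalb-agree : ∀ b {s s'} → AgreeOn (FVb b) s s' → ⟦ b ⟧b s ≡ ⟦ b ⟧b s'
evalb-agree btrue a = refl
evalb-agree bfalse a = refl
evalb-agree (e ≐e f) a =
  cong₂ (λ u w → does (u ℤ.≟ w)) (eval-agree e (agree-∪ˡ a)) (eval-agree f (agree-∪ʳ a))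
evalb-agree (e ≤e f) a =
  cong₂ (λ u w → does (u ℤ.≤? w)) (eval-agree e (agree-∪ˡ a)) (eval-agree f (agree-∪ʳ a))
evalb-agree (bnot b) a = cong not (evalb-agree b a)
evalb-agree (b band c) a = cong₂ _∧_ (evalb-agree b (agree-∪ˡ a)) (evalb-agree c (agree-∪ʳ a))
evalb-agree (b bor c) a = cong₂ _∨_ (evalb-agree b (agree-∪ˡ a)) (evalb-agree c (agree-∪ʳ a))

⊨-agree : ∀ P {s s' h} → AgreeOn (FV P) s s' → s , h ⊨ P → s' , h ⊨ P
⊨-agree (pure b) a p = trans (sym (evalb-agree b a)) p
⊨-agree emp a p = p
⊨-agree (e ↦ f) a (p , q)
  rewrite eval-agree e (agree-∪ˡ a) | eval-agree f (agree-∪ʳ a) = p , q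
⊨-agree (P ∗ Q) a (h₁ , h₂ , d , e , p , q) =
  h₁ , h₂ , d , e , ⊨-agree P (agree-∪ˡ a) p , ⊨-agree Q (agree-∪ʳ a) q
⊨-agree (P -∗ Q) a f h' d p =
  ⊨-agree Q (agree-∪ʳ a) (f h' d (⊨-agree P (agree-sym (agree-∪ˡ a)) p))
⊨-agree (P ∧a Q) a (p , q) = ⊨-agree P (agree-∪ˡ a) p , ⊨-agree Q (agree-∪ʳ a) q
⊨-agree (P ∨a Q) a (inj₁ p) = inj₁ (⊨-agree P (agree-∪ˡ a) p)
⊨-agree (P ∨a Q) a (inj₂ q) = inj₂ (⊨-agree Q (agree-∪ʳ a) q)
⊨-agree (P ⇒a Q) a f p = ⊨-agree Q (agree-∪ʳ a) (f (⊨-agree P (agree-sym (agree-∪ˡ a)) p))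
⊨-agree (¬a P) a f p = f (⊨-agree P (agree-sym a) p)
⊨-agree (∀a x P) a f v = ⊨-agree P (agree-upd a) (f v)
⊨-agree (∃a x P) a (v , p) = v , ⊨-agree P (agree-upd a) p

-- Resource invariants

SatEntry : Store → Heap → Entry → RSet → Set
SatEntry s h e D = (D (name e) × s , h ⊨ inv e) ⊎ (¬ D (name e) × IsEmpty h)

SatEntry-resp-D : ∀ {s h e D D'} → D (name e) ⇔ D' (name e) → SatEntry s h e D → SatEntry s h e D'
SatEntry-resp-D D⇔D' (inj₁ (d , p))    = inj₁ (Equivalence.to D⇔D' d , p)
SatEntry-resp-D D⇔D' (inj₂ (¬d , empty)) = inj₂ (¬d ∘ Equivalence.from D⇔D' , empty)

Sat⊛-resp-D : ∀ {Γ s h D D'} → All (λ e → D (name e) ⇔ D' (name e)) Γ →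
              Sat⊛ s h Γ D → Sat⊛ s h Γ D'
Sat⊛-resp-D []         sat = sat
Sat⊛-resp-D {e ∷ _} {D = D} {D'} (p ∷ ps) (h₁ , h₂ , d , q , entry , sat) =
  h₁ , h₂ , d , q , SatEntry-resp-D {e = e} {D} {D'} p entry , Sat⊛-resp-D ps sat

Sat⊛-∷ʳ⁺ : ∀ Γ e {s D} H hΓ hE → hΓ ⊥h hE → H ≐ (hΓ ⊎h hE) →
           Sat⊛ s hΓ Γ D → SatEntry s hE e D → Sat⊛ s H (Γ ++ [ e ]) D
Sat⊛-∷ʳ⁺ [] e H hΓ hE d q empty entry =
  hE , hΓ , ⊥h-sym hΓ hE d , ≐.trans q (⊎h-comm hΓ hE d) , entry , empty
Sat⊛-∷ʳ⁺ (e' ∷ Γ) e H hΓ hE d q (a , b , a⊥b , qΓ , entry' , sat) entry =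
  a , b ⊎h hE , ⊥h-⊎ʳ a b hE a⊥b (proj₁ ab⊥hE) , q' , entry' ,
  Sat⊛-∷ʳ⁺ Γ e (b ⊎h hE) b hE (proj₂ ab⊥hE) ≐.refl sat entry
  where
  ab⊥hE : a ⊥h hE × b ⊥h hE
  ab⊥hE = ⊥h-⊎ˡ⁻ a b hE (⊥h-respˡ-≐ hΓ (a ⊎h b) hE qΓ d)
  q' : H ≐ (a ⊎h (b ⊎h hE))
  q' = ≐.trans q (≐.trans (⊎h-cong hΓ (a ⊎h b) hE hE qΓ ≐.refl) (⊎h-assoc a b hE))

Sat⊛-∷ʳ⁻ : ∀ Γ e {s D} H → Sat⊛ s H (Γ ++ [ e ]) D →
           Σ Heap λ hΓ → Σ Heap λ hE →
             hΓ ⊥h hE × H ≐ (hΓ ⊎h hE) × Sat⊛ s hΓ Γ D × SatEntry s hE e D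
Sat⊛-∷ʳ⁻ [] e H (h₁ , h₂ , d , q , entry , empty) =
  h₂ , h₁ , ⊥h-sym h₁ h₂ d , ≐.trans q (⊎h-comm h₁ h₂ d) , empty , entry
Sat⊛-∷ʳ⁻ (e' ∷ Γ) e H (a , b , a⊥b , q , entry' , sat) with Sat⊛-∷ʳ⁻ Γ e b sat
... | bΓ , bE , bΓ⊥bE , qb , satΓ , entry =
  a ⊎h bΓ , bE , ⊥h-⊎ˡ a bΓ bE (proj₂ a⊥) bΓ⊥bE , q' ,
  (a , bΓ , proj₁ a⊥ , ≐.refl , entry' , satΓ) , entry
  where
  a⊥ : a ⊥h bΓ × a ⊥h bE
  a⊥ = ⊥h-⊎ʳ⁻ a bΓ bE (⊥h-respʳ-≐ a b (bΓ ⊎h bE) qb a⊥b)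
  q' : H ≐ ((a ⊎h bΓ) ⊎h bE)
  q' = ≐.trans q (≐.trans (⊎h-cong a a b (bΓ ⊎h bE) ≐.refl qb) (≐.sym (⊎h-assoc a bΓ bE)))

SatEntry-precise : ∀ {e s D} → Precise (inv e) → ∀ H h₁ h₂ → h₁ ⊑ H → h₂ ⊑ H →
                   SatEntry s h₁ e D → SatEntry s h₂ e D → h₁ ≐ h₂
SatEntry-precise {s = s} prec H h₁ h₂ s₁ s₂ (inj₁ (_ , p₁)) (inj₁ (_ , p₂)) =
  prec s H h₁ h₂ s₁ s₂ p₁ p₂
SatEntry-precise prec H h₁ h₂ s₁ s₂ (inj₁ (d , _)) (inj₂ (¬d , _)) = ⊥-elim (¬d d)
SatEntry-precise prec H h₁ h₂ s₁ s₂ (inj₂ (¬d , _)) (inj₁ (d , _)) = ⊥-elim (¬d d)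
SatEntry-precise prec H h₁ h₂ s₁ s₂ (inj₂ (_ , emp₁)) (inj₂ (_ , emp₂)) l =
  trans (emp₁ l) (sym (emp₂ l))

Sat⊛-precise : ∀ {Γ} → All (Precise ∘ inv) Γ → ∀ {s D} H h₁ h₂ → h₁ ⊑ H → h₂ ⊑ H →
               Sat⊛ s h₁ Γ D → Sat⊛ s h₂ Γ D → h₁ ≐ h₂
Sat⊛-precise [] H h₁ h₂ _ _ emp₁ emp₂ l = trans (emp₁ l) (sym (emp₂ l))
Sat⊛-precise {e ∷ _} (prec ∷ precs) {D = D} H h₁ h₂ s₁ s₂
             (a₁ , b₁ , d₁ , q₁ , e₁ , sat₁) (a₂ , b₂ , d₂ , q₂ , e₂ , sat₂) =
  ≐.trans q₁ (≐.trans (⊎h-cong a₁ a₂ b₁ b₂ a₁≐a₂ b₁≐b₂) (≐.sym q₂))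
  where
  ⊑₁ : a₁ ⊑ H × b₁ ⊑ H
  ⊑₁ = ⊎h-⊑⁻ a₁ b₁ H d₁ (⊑-respˡ-≐ h₁ (a₁ ⊎h b₁) H q₁ s₁)
  ⊑₂ : a₂ ⊑ H × b₂ ⊑ H
  ⊑₂ = ⊎h-⊑⁻ a₂ b₂ H d₂ (⊑-respˡ-≐ h₂ (a₂ ⊎h b₂) H q₂ s₂)
  a₁≐a₂ : a₁ ≐ a₂
  a₁≐a₂ = SatEntry-precise {e} {D = D} prec H a₁ a₂ (proj₁ ⊑₁) (proj₁ ⊑₂) e₁ e₂
  b₁≐b₂ : b₁ ≐ b₂
  b₁≐b₂ = Sat⊛-precise precs H b₁ b₂ (proj₂ ⊑₁) (proj₂ ⊑₂) sat₁ sat₂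

Sat⊛-frame-unique : ∀ {Γ} → All (Precise ∘ inv) Γ → ∀ {s D} h hG h' hG' →
                    h ⊥h hG → h' ⊥h hG' → (h ⊎h hG) ≐ (h' ⊎h hG') →
                    Sat⊛ s hG Γ D → Sat⊛ s hG' Γ D → h ≐ h'
Sat⊛-frame-unique precs h hG h' hG' d d' e sat sat' =
  ⊎h-cancelʳ h hG h' hG' d d' e
    (Sat⊛-precise precs (h ⊎h hG) hG hG' (⊑-⊎ʳ h hG d)
      (⊑-respʳ-≐ hG' (h' ⊎h hG') (h ⊎h hG) (≐.sym e) (⊑-⊎ʳ h' hG' d')) sat sat')

PVover-mono : ∀ {Γ S S'} → All (λ e → S (name e) → S' (name e)) Γ → PVover Γ S ⊆ PVover Γ S'
PVover-mono (p ∷ ps) (inj₁ (s , x∈)) = inj₁ (p s , x∈)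
PVover-mono (p ∷ ps) (inj₂ pv)       = inj₂ (PVover-mono ps pv)

PVover-++⁺ˡ : ∀ Γ {Δ S} → PVover Γ S ⊆ PVover (Γ ++ Δ) S
PVover-++⁺ˡ (e ∷ Γ) (inj₁ p)  = inj₁ p
PVover-++⁺ˡ (e ∷ Γ) (inj₂ pv) = inj₂ (PVover-++⁺ˡ Γ pv)

PVover-∷ʳ⁻ : ∀ Γ e {S x} → PVover (Γ ++ [ e ]) S x → PVover Γ S x ⊎ (S (name e) × vars e x)
PVover-∷ʳ⁻ []       e (inj₁ p)  = inj₂ p
PVover-∷ʳ⁻ (e' ∷ Γ) e (inj₁ p)  = inj₁ (inj₁ p)
PVover-∷ʳ⁻ (e' ∷ Γ) e (inj₂ pv) = Sum.map₁ inj₂ (PVover-∷ʳ⁻ Γ e pv)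

Unique-∷ʳ⁻ : ∀ Γ e → Unique (map name (Γ ++ [ e ])) → All (λ e' → name e' ≢ name e) Γ
Unique-∷ʳ⁻ []       e _ = []
Unique-∷ʳ⁻ (e' ∷ Γ) e (e'∉ ∷ u) with Allₚ.++⁻ʳ Γ (Allₚ.map⁻ e'∉)
... | e'≢e ∷ [] = e'≢e ∷ Unique-∷ʳ⁻ Γ e u

-- Program steps

updH-cong : ∀ H K l v → H ≐ K → updH H l v ≐ updH K l v
updH-cong H K l v e l' rewrite e l' = refl

remH-cong : ∀ H K l → H ≐ K → remH H l ≐ remH K l
remH-cong H K l e l' rewrite e l' = refl

allocH-cong : ∀ H K l vs → H ≐ K → allocH l vs H ≐ allocH l vs K
allocH-cong H K l []       e = e
allocH-cong H K l (v ∷ vs) e =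
  updH-cong (allocH (l ℤ.+ ℤ.1ℤ) vs H) (allocH (l ℤ.+ ℤ.1ℤ) vs K) l v
    (allocH-cong H K (l ℤ.+ ℤ.1ℤ) vs e)

FreeBlock-resp-≐ : ∀ H K l n → H ≐ K → FreeBlock H l n → FreeBlock K l n
FreeBlock-resp-≐ H K l zero    e free         = free
FreeBlock-resp-≐ H K l (suc n) e (lfree , free) =
  trans (sym (e l)) lfree , FreeBlock-resp-≐ H K (l ℤ.+ ℤ.1ℤ) n e free

BOk-resp-≐ : ∀ {c s H s' H'} → BOk c s H s' H' → ∀ K → H ≐ K →
             Σ Heap λ K' → BOk c s K s' K' × H' ≐ K'
BOk-resp-≐ assign K e = K , assign , e
BOk-resp-≐ (load x) K e = K , load (trans (sym (e _)) x) , e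
BOk-resp-≐ {[ a ]≔ b} {s} {H} (store x) K e =
  updH K (⟦ a ⟧ s) (⟦ b ⟧ s) , store (trans (sym (e _)) x) , updH-cong H K _ _ e
BOk-resp-≐ {x ≔cons es} {s} {H} (cons l free) K e =
  allocH l vs K , cons l (FreeBlock-resp-≐ H K l _ e free) , allocH-cong H K l vs e
  where
  vs : List Val
  vs = map (λ e → ⟦ e ⟧ s) es
BOk-resp-≐ {dispose a} {s} {H} (disp x) K e =
  remH K (⟦ a ⟧ s) , disp (trans (sym (e _)) x) , remH-cong H K _ e

⟶p-resp-≐ : ∀ {C C' s s' H H' ρ ρ'} → C , ⟨ s , H , ρ ⟩ ⟶p C' , ⟨ s' , H' , ρ' ⟩ →
            ∀ K → H ≐ K → Σ Heap λ K' → C , ⟨ s , K , ρ ⟩ ⟶p C' , ⟨ s' , K' , ρ' ⟩ × H' ≐ K'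
⟶p-resp-≐ S1           K e = K , S1 , e
⟶p-resp-≐ (S2 st)      K e = map₂ (map₁ S2) (⟶p-resp-≐ st K e)
⟶p-resp-≐ LP           K e = K , LP , e
⟶p-resp-≐ (IF1 b)      K e = K , IF1 b , e
⟶p-resp-≐ (IF2 b)      K e = K , IF2 b , e
⟶p-resp-≐ (P1 st)      K e = map₂ (map₁ P1) (⟶p-resp-≐ st K e)
⟶p-resp-≐ (P2 st)      K e = map₂ (map₁ P2) (⟶p-resp-≐ st K e)
⟶p-resp-≐ P3           K e = K , P3 , e
⟶p-resp-≐ (R0 r∉)      K e = K , R0 r∉ , e
⟶p-resp-≐ (R1 r∉ l st) K e = map₂ (map₁ (R1 r∉ l)) (⟶p-resp-≐ st K e)
⟶p-resp-≐ (R2 r∉ l st) K e = map₂ (map₁ (R2 r∉ l)) (⟶p-resp-≐ st K e)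
⟶p-resp-≐ (W0 d b)     K e = K , W0 d b , e
⟶p-resp-≐ (W1 o st)    K e = map₂ (map₁ (W1 o)) (⟶p-resp-≐ st K e)
⟶p-resp-≐ (W2 o)       K e = K , W2 o , e
⟶p-resp-≐ (BCT b)      K e = map₂ (map₁ BCT) (BOk-resp-≐ b K e)

BAbort-⊑ : ∀ {c s H} h → h ⊑ H → BAbort c s H → BAbort c s h
BAbort-⊑ {H = H} h h⊑H (load-abort x)  = load-abort (⊑-nothing h H h⊑H x)
BAbort-⊑ {H = H} h h⊑H (store-abort x) = store-abort (⊑-nothing h H h⊑H x)
BAbort-⊑ {H = H} h h⊑H (disp-abort x)  = disp-abort (⊑-nothing h H h⊑H x)

⟶abort-⊑ : ∀ {C s H ρ} h → h ⊑ H → C , ⟨ s , H , ρ ⟩ ⟶abort → C , ⟨ s , h , ρ ⟩ ⟶abort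
⟶abort-⊑ h h⊑H (RA p)          = RA p
⟶abort-⊑ h h⊑H (WA p)          = WA p
⟶abort-⊑ h h⊑H (RA1 r∉ l ab)   = RA1 r∉ l (⟶abort-⊑ h h⊑H ab)
⟶abort-⊑ h h⊑H (RA2 r∉ l ab)   = RA2 r∉ l (⟶abort-⊑ h h⊑H ab)
⟶abort-⊑ h h⊑H (BCA b)         = BCA (BAbort-⊑ h h⊑H b)
⟶abort-⊑ h h⊑H (SA ab)         = SA (⟶abort-⊑ h h⊑H ab)
⟶abort-⊑ h h⊑H (WA1 ab)        = WA1 (⟶abort-⊑ h h⊑H ab)
⟶abort-⊑ h h⊑H (WA2 p)         = WA2 p
⟶abort-⊑ h h⊑H (PA1 ab)        = PA1 (⟶abort-⊑ h h⊑H ab)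
⟶abort-⊑ h h⊑H (PA2 ab)        = PA2 (⟶abort-⊑ h h⊑H ab)

Locked? : ∀ C x → Dec (Locked C x)
Locked? skip x = no λ ()
Locked? (basic c) x = no λ ()
Locked? (C₁ ⨾ C₂) x = Locked? C₁ x
Locked? (IF B THEN C₁ ELSE C₂) x = no λ ()
Locked? (WHILE B DO C) x = no λ ()
Locked? (RESOURCE r IN C) x with Locked? C x | x ℕ.≟ r
... | yes l | no x≢r = yes (l , x≢r)
... | yes _ | yes x≡r = no λ (_ , x≢r) → x≢r x≡r
... | no ¬l | _ = no (¬l ∘ proj₁)
Locked? (WITH r WHEN B DO C) x = no λ ()
Locked? (C₁ ∥ C₂) x with Locked? C₁ x | Locked? C₂ x
... | yes l₁ | _      = yes (inj₁ l₁)
... | no _   | yes l₂ = yes (inj₂ l₂)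
... | no ¬l₁ | no ¬l₂ = no [ ¬l₁ , ¬l₂ ]′
Locked? (WITHIN r DO C) x with Locked? C x | r ℕ.≟ x
... | yes l  | _       = yes (inj₁ l)
... | no _   | yes r≡x = yes (inj₂ r≡x)
... | no ¬l  | no r≢x  = no [ ¬l , r≢x ]′

-- Only ¬¬: the abort rules RA1/RA2 require r ∉ ρ, which is undecidable.
locked⇒owned : ∀ C {s h ρ x} → ¬ (C , ⟨ s , h , ρ ⟩ ⟶abort) → Locked C x → ¬ ¬ O ρ x
locked⇒owned (C₁ ⨾ C₂) safe l = locked⇒owned C₁ (safe ∘ SA) l
locked⇒owned (C₁ ∥ C₂) safe (inj₁ l) = locked⇒owned C₁ (safe ∘ PA1) l
locked⇒owned (C₁ ∥ C₂) safe (inj₂ l) = locked⇒owned C₂ (safe ∘ PA2) l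
locked⇒owned (RESOURCE r IN C) {ρ = cfg O L D} safe (l , x≢r) ¬o with Locked? C r
... | yes lr = locked⇒owned C (safe ∘ RA1 (safe ∘ RA) lr) l [ ¬o , x≢r ∘ sym ]′
... | no ¬lr = locked⇒owned C (safe ∘ RA2 (safe ∘ RA) ¬lr) l ¬o
locked⇒owned (WITHIN r DO C) safe (inj₁ l) ¬o = locked⇒owned C (safe ∘ WA1) l (¬o ∘ proj₁)
locked⇒owned (WITHIN r DO C) safe (inj₂ refl) ¬o = safe (WA2 ¬o)

env-local : ∀ {Γ} → All (Precise ∘ inv) Γ →
            ∀ {C C' A s s' O L D H' ρ'} h hG → h ⊥h hG → Sat⊛ s hG Γ D →
            C , ⟨ s , h ⊎h hG , cfg O L D ⟩ ⟶e[ A , Γ ] C' , ⟨ s' , H' , ρ' ⟩ →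
            Σ Heap λ hG' → h ⊥h hG' × H' ≐ (h ⊎h hG') × Sat⊛ s' hG' Γ (Config.D ρ')
env-local precs h hG d sat (env {h = he} {hGe} {hG'} _ _ _ dₑ qₑ satₑ dₑ' qₑ' satₑ') =
  hG' , ⊥h-respˡ-≐ he h hG' (≐.sym h≐he) dₑ' ,
  ≐.trans qₑ' (⊎h-cong he h hG' hG' (≐.sym h≐he) ≐.refl) , satₑ'
  where
  h≐he : h ≐ he
  h≐he = Sat⊛-frame-unique precs h hG he hGe d dₑ qₑ sat satₑ

-- Resource configurations

-- Removing r from a configuration and adding it back is the identity only up to ≈ρ.
_≈ρ_ : Config → Config → Set
ρ ≈ρ ρ' = O ρ ≋ O ρ' × L ρ ≋ L ρ' × D ρ ≋ D ρ'

≈ρ-sym : ∀ {ρ ρ'} → ρ ≈ρ ρ' → ρ' ≈ρ ρ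
≈ρ-sym (o , l , d) = Setₚ.≐-sym o , Setₚ.≐-sym l , Setₚ.≐-sym d

∪-congˡ : ∀ {P P' Q : RSet} → P ≋ P' → (P ∪ Q) ≋ (P' ∪ Q)
∪-congˡ (P⊆P' , P'⊆P) = Sum.map₁ P⊆P' , Sum.map₁ P'⊆P

－-cong : ∀ {P P' : RSet} r → P ≋ P' → (P － r) ≋ (P' － r)
－-cong r (P⊆P' , P'⊆P) = map₁ P⊆P' , map₁ P'⊆P

∖ρ-cong : ∀ {ρ ρ'} r → ρ ≈ρ ρ' → (ρ ∖ρ r) ≈ρ (ρ' ∖ρ r)
∖ρ-cong r (o , l , d) = －-cong r o , －-cong r l , －-cong r d

∈ρ-resp-≈ρ : ∀ {ρ ρ' x} → ρ ≈ρ ρ' → x ∈ρ ρ → x ∈ρ ρ'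
∈ρ-resp-≈ρ (o , l , d) = Sum.map (proj₁ o) (Sum.map (proj₁ l) (proj₁ d))

IsConfig-resp-≈ρ : ∀ {ρ ρ'} → ρ ≈ρ ρ' → IsConfig ρ → IsConfig ρ'
IsConfig-resp-≈ρ (o , l , d) c x =
  (λ (o' , l') → proj₁ (c x) (proj₂ o o' , proj₂ l l')) ,
  (λ (o' , d') → proj₁ (proj₂ (c x)) (proj₂ o o' , proj₂ d d')) ,
  (λ (l' , d') → proj₂ (proj₂ (c x)) (proj₂ l l' , proj₂ d d'))

Sat⊛-resp-≋ : ∀ {Γ s h D D'} → D ≋ D' → Sat⊛ s h Γ D → Sat⊛ s h Γ D'
Sat⊛-resp-≋ {Γ} (D⊆D' , D'⊆D) = Sat⊛-resp-D (All.universal (λ e → mk⇔ D⊆D' D'⊆D) Γ)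

⟶p-resp-≈ρ : ∀ {C C' s s' H H' ρ₁ ρ₁'} → C , ⟨ s , H , ρ₁ ⟩ ⟶p C' , ⟨ s' , H' , ρ₁' ⟩ →
             ∀ {ρ₂} → ρ₁ ≈ρ ρ₂ →
             Σ Config λ ρ₂' → C , ⟨ s , H , ρ₂ ⟩ ⟶p C' , ⟨ s' , H' , ρ₂' ⟩ × ρ₁' ≈ρ ρ₂'
⟶p-resp-≈ρ S1 {ρ₂} e = ρ₂ , S1 , e
⟶p-resp-≈ρ (S2 st) e = map₂ (map₁ S2) (⟶p-resp-≈ρ st e)
⟶p-resp-≈ρ LP {ρ₂} e = ρ₂ , LP , e
⟶p-resp-≈ρ (IF1 b) {ρ₂} e = ρ₂ , IF1 b , e
⟶p-resp-≈ρ (IF2 b) {ρ₂} e = ρ₂ , IF2 b , e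
⟶p-resp-≈ρ (P1 st) e = map₂ (map₁ P1) (⟶p-resp-≈ρ st e)
⟶p-resp-≈ρ (P2 st) e = map₂ (map₁ P2) (⟶p-resp-≈ρ st e)
⟶p-resp-≈ρ P3 {ρ₂} e = ρ₂ , P3 , e
⟶p-resp-≈ρ (R0 r∉) {ρ₂} e = ρ₂ , R0 (r∉ ∘ ∈ρ-resp-≈ρ (≈ρ-sym e)) , e
⟶p-resp-≈ρ (R1 {r = r} r∉ l st) {cfg O₂ L₂ D₂} (o , l' , d)
  with ⟶p-resp-≈ρ st {cfg (O₂ ∪ ｛ r ｝) L₂ D₂} (∪-congˡ o , l' , d)
... | ρ₂' , st₂ , e' = ρ₂' ∖ρ r , R1 (r∉ ∘ ∈ρ-resp-≈ρ (≈ρ-sym (o , l' , d))) l st₂ , ∖ρ-cong r e'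
⟶p-resp-≈ρ (R2 {r = r} r∉ l st) {cfg O₂ L₂ D₂} (o , l' , d)
  with ⟶p-resp-≈ρ st {cfg O₂ L₂ (D₂ ∪ ｛ r ｝)} (o , l' , ∪-congˡ d)
... | ρ₂' , st₂ , e' = ρ₂' ∖ρ r , R2 (r∉ ∘ ∈ρ-resp-≈ρ (≈ρ-sym (o , l' , d))) l st₂ , ∖ρ-cong r e'
⟶p-resp-≈ρ (W0 {r = r} dr b) {cfg O₂ L₂ D₂} (o , l , d) =
  cfg (O₂ ∪ ｛ r ｝) L₂ (D₂ － r) , W0 (proj₁ d dr) b , ∪-congˡ o , l , －-cong r d
⟶p-resp-≈ρ (W1 {r = r} or st) {cfg O₂ L₂ D₂} (o , l , d)
  with ⟶p-resp-≈ρ st {cfg (O₂ － r) L₂ D₂} (－-cong r o , l , d)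
... | ρ₂' , st₂ , (o' , l' , d') =
  cfg (O ρ₂' ∪ ｛ r ｝) (L ρ₂') (D ρ₂') , W1 (proj₁ o or) st₂ , ∪-congˡ o' , l' , d'
⟶p-resp-≈ρ (W2 {r = r} or) {cfg O₂ L₂ D₂} (o , l , d) =
  cfg (O₂ － r) L₂ (D₂ ∪ ｛ r ｝) , W2 (proj₁ o or) , －-cong r o , l , ∪-congˡ d
⟶p-resp-≈ρ (BCT b) {ρ₂} e = ρ₂ , BCT b , e

⟶abort-resp-≈ρ : ∀ {C s H ρ₁ ρ₂} → ρ₁ ≈ρ ρ₂ → C , ⟨ s , H , ρ₁ ⟩ ⟶abort → C , ⟨ s , H , ρ₂ ⟩ ⟶abort
⟶abort-resp-≈ρ e (RA r∈) = RA (∈ρ-resp-≈ρ e r∈)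
⟶abort-resp-≈ρ e (WA r∉) = WA (r∉ ∘ ∈ρ-resp-≈ρ (≈ρ-sym e))
⟶abort-resp-≈ρ {ρ₂ = cfg O₂ L₂ D₂} (o , l , d) (RA1 r∉ lr ab) =
  RA1 (r∉ ∘ ∈ρ-resp-≈ρ (≈ρ-sym (o , l , d))) lr (⟶abort-resp-≈ρ (∪-congˡ o , l , d) ab)
⟶abort-resp-≈ρ {ρ₂ = cfg O₂ L₂ D₂} (o , l , d) (RA2 r∉ lr ab) =
  RA2 (r∉ ∘ ∈ρ-resp-≈ρ (≈ρ-sym (o , l , d))) lr (⟶abort-resp-≈ρ (o , l , ∪-congˡ d) ab)
⟶abort-resp-≈ρ e (BCA b) = BCA b
⟶abort-resp-≈ρ e (SA ab) = SA (⟶abort-resp-≈ρ e ab)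
⟶abort-resp-≈ρ e (WA1 {r = r} ab) = WA1 (⟶abort-resp-≈ρ (∖ρ-cong r e) ab)
⟶abort-resp-≈ρ (o , _) (WA2 ¬or) = WA2 (¬or ∘ proj₂ o)
⟶abort-resp-≈ρ e (PA1 ab) = PA1 (⟶abort-resp-≈ρ e ab)
⟶abort-resp-≈ρ e (PA2 ab) = PA2 (⟶abort-resp-≈ρ e ab)

⟶e-resp-≈ρ : ∀ {C C' A Γ s s' H H' ρ₁ ρ₁'} → C , ⟨ s , H , ρ₁ ⟩ ⟶e[ A , Γ ] C' , ⟨ s' , H' , ρ₁' ⟩ →
             ∀ {ρ₂} → ρ₁ ≈ρ ρ₂ →
             Σ Config λ ρ₂' → C , ⟨ s , H , ρ₂ ⟩ ⟶e[ A , Γ ] C' , ⟨ s' , H' , ρ₂' ⟩ × ρ₁' ≈ρ ρ₂'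
⟶e-resp-≈ρ (env {h = h} {hG} {hG'} {L = L} {D} {L'} {D'} agree LD⇔ c d q sat d' q' sat')
           {cfg O₂ L₂ D₂} (o , l , dd) =
  cfg O₂ L' D' ,
  env {h = h} {hG} {hG'} agree (λ x → ⇔.trans LD₂⇔LD (LD⇔ x))
    (IsConfig-resp-≈ρ (o , Setₚ.≐-refl , Setₚ.≐-refl) c) d q (Sat⊛-resp-≋ dd sat) d' q' sat' ,
  o , Setₚ.≐-refl , Setₚ.≐-refl
  where
  LD₂⇔LD : ∀ {x} → (L₂ x ⊎ D₂ x) ⇔ (L x ⊎ D x)
  LD₂⇔LD = mk⇔ (Sum.map (proj₂ l) (proj₂ dd)) (Sum.map (proj₁ l) (proj₁ dd))

∈ρ-∪O-split : ∀ O L D (P : RSet) {x} → x ∈ρ cfg (O ∪ P) L D → x ∈ρ cfg O L D ⊎ P x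
∈ρ-∪O-split _ _ _ _ (inj₁ (inj₁ o)) = inj₁ (inj₁ o)
∈ρ-∪O-split _ _ _ _ (inj₁ (inj₂ p)) = inj₂ p
∈ρ-∪O-split _ _ _ _ (inj₂ ld)       = inj₁ (inj₂ ld)

∈ρ-∪D-split : ∀ O L D (P : RSet) {x} → x ∈ρ cfg O L (D ∪ P) → x ∈ρ cfg O L D ⊎ P x
∈ρ-∪D-split _ _ _ _ (inj₂ (inj₂ (inj₁ d))) = inj₁ (inj₂ (inj₂ d))
∈ρ-∪D-split _ _ _ _ (inj₂ (inj₂ (inj₂ p))) = inj₂ p
∈ρ-∪D-split _ _ _ _ (inj₁ o)               = inj₁ (inj₁ o)
∈ρ-∪D-split _ _ _ _ (inj₂ (inj₁ l))        = inj₁ (inj₂ (inj₁ l))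

∈ρ-∖ρ⁺ : ∀ ρ {x r} → x ∈ρ ρ → x ≢ r → x ∈ρ (ρ ∖ρ r)
∈ρ-∖ρ⁺ ρ x∈ x≢r = Sum.map (_, x≢r) (Sum.map (_, x≢r) (_, x≢r)) x∈

∈ρ-∖ρ⁻ : ∀ ρ {x r} → x ∈ρ (ρ ∖ρ r) → x ∈ρ ρ × x ≢ r
∈ρ-∖ρ⁻ ρ (inj₁ (o , x≢r))        = inj₁ o , x≢r
∈ρ-∖ρ⁻ ρ (inj₂ (inj₁ (l , x≢r))) = inj₂ (inj₁ l) , x≢r
∈ρ-∖ρ⁻ ρ (inj₂ (inj₂ (d , x≢r))) = inj₂ (inj₂ d) , x≢r

∉-∖ρ : ∀ ρ r → ¬ r ∈ρ (ρ ∖ρ r)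
∉-∖ρ ρ r r∈ = proj₂ (∈ρ-∖ρ⁻ ρ r∈) refl

－-≋ : ∀ {P : RSet} {r} → ¬ P r → P ≋ (P － r)
－-≋ ¬Pr = (λ p → p , λ { refl → ¬Pr p }) , proj₁

－-∪-≋ : ∀ {P : RSet} {r} → P r → P ≋ ((P － r) ∪ ｛ r ｝)
－-∪-≋ {P} {r} Pr = to , [ proj₁ , (λ { refl → Pr }) ]′
  where
  to : P ⊆ ((P － r) ∪ ｛ r ｝)
  to {x} p with x ℕ.≟ r
  ... | yes refl = inj₂ refl
  ... | no x≢r   = inj₁ (p , x≢r)

∉ρ-resp-⇔ : ∀ O {L D L' D' : RSet} r → ¬ r ∈ρ cfg O L D → (∀ x → (L x ⊎ D x) ⇔ (L' x ⊎ D' x)) →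
            ¬ r ∈ρ cfg O L' D'
∉ρ-resp-⇔ O r r∉ LD⇔ = [ r∉ ∘ inj₁ , r∉ ∘ inj₂ ∘ Equivalence.from (LD⇔ r) ]′

⊎-extendʳ-⇔ : ∀ {a b c d p : Set} → (a ⊎ b) ⇔ (c ⊎ d) → (a ⊎ (b ⊎ p)) ⇔ (c ⊎ (d ⊎ p))
⊎-extendʳ-⇔ e = mk⇔ (extend (Equivalence.to e)) (extend (Equivalence.from e))
  where
  extend : ∀ {a b c d p : Set} → (a ⊎ b → c ⊎ d) → a ⊎ (b ⊎ p) → c ⊎ (d ⊎ p)
  extend f = [ Sum.map₂ inj₁ ∘ f ∘ inj₁ , [ Sum.map₂ inj₁ ∘ f ∘ inj₂ , inj₂ ∘ inj₂ ]′ ]′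

⟶p-names : ∀ {C C' s s' H H' ρ ρ'} → C , ⟨ s , H , ρ ⟩ ⟶p C' , ⟨ s' , H' , ρ' ⟩ →
           ∀ {x} → x ∈ρ ρ ⇔ x ∈ρ ρ'
⟶p-names S1       = ⇔.refl
⟶p-names (S2 st)  = ⟶p-names st
⟶p-names LP       = ⇔.refl
⟶p-names (IF1 _)  = ⇔.refl
⟶p-names (IF2 _)  = ⇔.refl
⟶p-names (P1 st)  = ⟶p-names st
⟶p-names (P2 st)  = ⟶p-names st
⟶p-names P3       = ⇔.refl
⟶p-names (R0 _)   = ⇔.refl
⟶p-names (R1 {r = r} {O = O} {L} {D} {ρ' = ρ'} r∉ _ st) = mk⇔
  (λ x∈ → ∈ρ-∖ρ⁺ ρ' (Equivalence.to (⟶p-names st) (Sum.map₁ inj₁ x∈)) λ { refl → r∉ x∈ })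
  (λ x∈ → let x∈ρ' , x≢r = ∈ρ-∖ρ⁻ ρ' x∈ in
    [ (λ x∈ρ → x∈ρ) , (λ { refl → ⊥-elim (x≢r refl) }) ]′
      (∈ρ-∪O-split O L D ｛ r ｝ (Equivalence.from (⟶p-names st) x∈ρ')))
⟶p-names (R2 {r = r} {O = O} {L} {D} {ρ' = ρ'} r∉ _ st) = mk⇔
  (λ x∈ → ∈ρ-∖ρ⁺ ρ' (Equivalence.to (⟶p-names st) (Sum.map₂ (Sum.map₂ inj₁) x∈)) λ { refl → r∉ x∈ })
  (λ x∈ → let x∈ρ' , x≢r = ∈ρ-∖ρ⁻ ρ' x∈ in
    [ (λ x∈ρ → x∈ρ) , (λ { refl → ⊥-elim (x≢r refl) }) ]′
      (∈ρ-∪D-split O L D ｛ r ｝ (Equivalence.from (⟶p-names st) x∈ρ')))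
⟶p-names (W0 {r = r} {O = O} {L} {D} dr _) {x} = mk⇔ to from
  where
  to : x ∈ρ cfg O L D → x ∈ρ cfg (O ∪ ｛ r ｝) L (D － r)
  to (inj₁ o)        = inj₁ (inj₁ o)
  to (inj₂ (inj₁ l)) = inj₂ (inj₁ l)
  to (inj₂ (inj₂ d)) with x ℕ.≟ r
  ... | yes refl = inj₁ (inj₂ refl)
  ... | no x≢r   = inj₂ (inj₂ (d , x≢r))
  from : x ∈ρ cfg (O ∪ ｛ r ｝) L (D － r) → x ∈ρ cfg O L D
  from (inj₁ (inj₁ o))      = inj₁ o
  from (inj₁ (inj₂ refl))   = inj₂ (inj₂ dr)
  from (inj₂ (inj₁ l))      = inj₂ (inj₁ l)
  from (inj₂ (inj₂ (d , _))) = inj₂ (inj₂ d)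
⟶p-names (W1 {r = r} {O = O} {L} {D} {O' = O'} {L'} {D'} or st) {x} = mk⇔ to from
  where
  to : x ∈ρ cfg O L D → x ∈ρ cfg (O' ∪ ｛ r ｝) L' D'
  to (inj₁ o) with x ℕ.≟ r
  ... | yes refl = inj₁ (inj₂ refl)
  ... | no x≢r   = Sum.map₁ inj₁ (Equivalence.to (⟶p-names st) (inj₁ (o , x≢r)))
  to (inj₂ ld) = Sum.map₁ inj₁ (Equivalence.to (⟶p-names st) (inj₂ ld))
  from : x ∈ρ cfg (O' ∪ ｛ r ｝) L' D' → x ∈ρ cfg O L D
  from x∈ with ∈ρ-∪O-split O' L' D' ｛ r ｝ x∈
  ... | inj₁ x∈' = Sum.map₁ proj₁ (Equivalence.from (⟶p-names st) x∈')
  ... | inj₂ refl = inj₁ or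
⟶p-names (W2 {r = r} {O = O} {L} {D} or) {x} = mk⇔ to from
  where
  to : x ∈ρ cfg O L D → x ∈ρ cfg (O － r) L (D ∪ ｛ r ｝)
  to (inj₁ o) with x ℕ.≟ r
  ... | yes refl = inj₂ (inj₂ (inj₂ refl))
  ... | no x≢r   = inj₁ (o , x≢r)
  to (inj₂ (inj₁ l)) = inj₂ (inj₁ l)
  to (inj₂ (inj₂ d)) = inj₂ (inj₂ (inj₁ d))
  from : x ∈ρ cfg (O － r) L (D ∪ ｛ r ｝) → x ∈ρ cfg O L D
  from x∈ with ∈ρ-∪D-split (O － r) L D ｛ r ｝ x∈
  ... | inj₁ x∈' = Sum.map₁ proj₁ x∈'
  ... | inj₂ refl = inj₁ or
⟶p-names (BCT _) = ⇔.refl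

⟶p-L⊆ : ∀ {C C' s s' H H' ρ ρ'} → C , ⟨ s , H , ρ ⟩ ⟶p C' , ⟨ s' , H' , ρ' ⟩ → L ρ' ⊆ L ρ
⟶p-L⊆ S1 l = l
⟶p-L⊆ (S2 st) l = ⟶p-L⊆ st l
⟶p-L⊆ LP l = l
⟶p-L⊆ (IF1 _) l = l
⟶p-L⊆ (IF2 _) l = l
⟶p-L⊆ (P1 st) l = ⟶p-L⊆ st l
⟶p-L⊆ (P2 st) l = ⟶p-L⊆ st l
⟶p-L⊆ P3 l = l
⟶p-L⊆ (R0 _) l = l
⟶p-L⊆ (R1 _ _ st) (l , _) = ⟶p-L⊆ st l
⟶p-L⊆ (R2 _ _ st) (l , _) = ⟶p-L⊆ st l
⟶p-L⊆ (W0 _ _) l = l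
⟶p-L⊆ (W1 _ st) l = ⟶p-L⊆ st l
⟶p-L⊆ (W2 _) l = l
⟶p-L⊆ (BCT _) l = l

IsConfig-⊆ : ∀ {O L D O' L' D'} → O' ⊆ O → L' ⊆ L → D' ⊆ D →
             IsConfig (cfg O L D) → IsConfig (cfg O' L' D')
IsConfig-⊆ o l d c x =
  (λ (o' , l') → proj₁ (c x) (o o' , l l')) ,
  (λ (o' , d') → proj₁ (proj₂ (c x)) (o o' , d d')) ,
  (λ (l' , d') → proj₂ (proj₂ (c x)) (l l' , d d'))

IsConfig-∖ρ : ∀ {ρ} r → IsConfig ρ → IsConfig (ρ ∖ρ r)
IsConfig-∖ρ r = IsConfig-⊆ proj₁ proj₁ proj₁

IsConfig-∪O : ∀ {O L D} r → IsConfig (cfg O L D) → ¬ (L r ⊎ D r) → IsConfig (cfg (O ∪ ｛ r ｝) L D)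
IsConfig-∪O r c r∉ x =
  (λ { (inj₁ o , l) → proj₁ (c x) (o , l) ; (inj₂ refl , l) → r∉ (inj₁ l) }) ,
  (λ { (inj₁ o , d) → proj₁ (proj₂ (c x)) (o , d) ; (inj₂ refl , d) → r∉ (inj₂ d) }) ,
  proj₂ (proj₂ (c x))

IsConfig-∪D : ∀ {O L D} r → IsConfig (cfg O L D) → ¬ (O r ⊎ L r) → IsConfig (cfg O L (D ∪ ｛ r ｝))
IsConfig-∪D r c r∉ x =
  proj₁ (c x) ,
  (λ { (o , inj₁ d) → proj₁ (proj₂ (c x)) (o , d) ; (o , inj₂ refl) → r∉ (inj₁ o) }) ,
  (λ { (l , inj₁ d) → proj₂ (proj₂ (c x)) (l , d) ; (l , inj₂ refl) → r∉ (inj₂ l) })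

⟶p-IsConfig : ∀ {C C' s s' H H' ρ ρ'} → C , ⟨ s , H , ρ ⟩ ⟶p C' , ⟨ s' , H' , ρ' ⟩ →
              IsConfig ρ → IsConfig ρ'
⟶p-IsConfig S1 c = c
⟶p-IsConfig (S2 st) c = ⟶p-IsConfig st c
⟶p-IsConfig LP c = c
⟶p-IsConfig (IF1 _) c = c
⟶p-IsConfig (IF2 _) c = c
⟶p-IsConfig (P1 st) c = ⟶p-IsConfig st c
⟶p-IsConfig (P2 st) c = ⟶p-IsConfig st c
⟶p-IsConfig P3 c = c
⟶p-IsConfig (R0 _) c = c
⟶p-IsConfig (R1 {r = r} r∉ _ st) c = IsConfig-∖ρ r (⟶p-IsConfig st (IsConfig-∪O r c (r∉ ∘ inj₂)))
⟶p-IsConfig (R2 {r = r} r∉ _ st) c =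
  IsConfig-∖ρ r (⟶p-IsConfig st (IsConfig-∪D r c (r∉ ∘ [ inj₁ , inj₂ ∘ inj₁ ]′)))
⟶p-IsConfig (W0 {r = r} dr _) c =
  IsConfig-∪O r (IsConfig-⊆ (λ o → o) (λ l → l) proj₁ c)
    [ (λ l → proj₂ (proj₂ (c r)) (l , dr)) , (λ (_ , r≢r) → r≢r refl) ]′
⟶p-IsConfig (W1 {r = r} {L' = L'} {D'} or st) c =
  IsConfig-∪O r (⟶p-IsConfig st (IsConfig-⊆ proj₁ (λ l → l) (λ d → d) c)) r∉
  where
  r∉ : ¬ (L' r ⊎ D' r)
  r∉ r∈ with Equivalence.from (⟶p-names st) (inj₂ r∈)
  ... | inj₁ (_ , r≢r) = r≢r refl
  ... | inj₂ (inj₁ l) = proj₁ (c r) (or , l)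
  ... | inj₂ (inj₂ d) = proj₁ (proj₂ (c r)) (or , d)
⟶p-IsConfig (W2 {r = r} or) c =
  IsConfig-∪D r (IsConfig-⊆ proj₁ (λ l → l) (λ d → d) c)
    [ (λ (_ , r≢r) → r≢r refl) , (λ l → proj₁ (c r) (or , l)) ]′
⟶p-IsConfig (BCT _) c = c

OwnedUnlocked : Cmd → Config → RName → Set
OwnedUnlocked C ρ x = O ρ x × ¬ Locked C x

⟶p-OwnedUnlocked⁻ : ∀ {C C' s s' H H' ρ ρ' x} → C , ⟨ s , H , ρ ⟩ ⟶p C' , ⟨ s' , H' , ρ' ⟩ →
                     OwnedUnlocked C' ρ' x → OwnedUnlocked C ρ x
⟶p-OwnedUnlocked⁻ S1 (o , _) = o , λ ()
⟶p-OwnedUnlocked⁻ (S2 st) ou = ⟶p-OwnedUnlocked⁻ st ou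
⟶p-OwnedUnlocked⁻ LP (o , _) = o , λ ()
⟶p-OwnedUnlocked⁻ (IF1 _) (o , _) = o , λ ()
⟶p-OwnedUnlocked⁻ (IF2 _) (o , _) = o , λ ()
⟶p-OwnedUnlocked⁻ (P1 st) (o , ¬l) =
  map₂ (λ ¬l₁ → [ ¬l₁ , ¬l ∘ inj₂ ]′) (⟶p-OwnedUnlocked⁻ st (o , ¬l ∘ inj₁))
⟶p-OwnedUnlocked⁻ (P2 st) (o , ¬l) =
  map₂ (λ ¬l₂ → [ ¬l ∘ inj₁ , ¬l₂ ]′) (⟶p-OwnedUnlocked⁻ st (o , ¬l ∘ inj₂))
⟶p-OwnedUnlocked⁻ P3 (o , _) = o , [ (λ ()) , (λ ()) ]′
⟶p-OwnedUnlocked⁻ (R0 _) (o , _) = o , λ ()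
⟶p-OwnedUnlocked⁻ (R1 _ _ st) ((o , x≢r) , ¬l) with ⟶p-OwnedUnlocked⁻ st (o , ¬l ∘ (_, x≢r))
... | inj₁ o' , ¬l' = o' , ¬l' ∘ proj₁
... | inj₂ refl , _ = ⊥-elim (x≢r refl)
⟶p-OwnedUnlocked⁻ (R2 _ _ st) ((o , x≢r) , ¬l) =
  map₂ (_∘ proj₁) (⟶p-OwnedUnlocked⁻ st (o , ¬l ∘ (_, x≢r)))
⟶p-OwnedUnlocked⁻ (W0 _ _) (inj₁ o , _) = o , λ ()
⟶p-OwnedUnlocked⁻ (W0 _ _) (inj₂ r≡x , ¬l) = ⊥-elim (¬l (inj₂ r≡x))
⟶p-OwnedUnlocked⁻ (W1 _ st) (inj₁ o , ¬l) =
  Product.map proj₁ (λ ¬l' → [ ¬l' , ¬l ∘ inj₂ ]′) (⟶p-OwnedUnlocked⁻ st (o , ¬l ∘ inj₁))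
⟶p-OwnedUnlocked⁻ (W1 _ st) (inj₂ r≡x , ¬l) = ⊥-elim (¬l (inj₂ r≡x))
⟶p-OwnedUnlocked⁻ (W2 _) ((o , x≢r) , ¬l) = o , [ (λ ()) , (λ { refl → x≢r refl }) ]′
⟶p-OwnedUnlocked⁻ (BCT _) (o , _) = o , λ ()

⟶p-owned⇒locked : ∀ {C C' s s' H H' ρ ρ' x} → C , ⟨ s , H , ρ ⟩ ⟶p C' , ⟨ s' , H' , ρ' ⟩ →
                  (O ρ x → Locked C x) → O ρ' x → Locked C' x
⟶p-owned⇒locked {C' = C'} {x = x} st owned⇒locked o' with Locked? C' x
... | yes l  = l
... | no ¬l with ⟶p-OwnedUnlocked⁻ st (o' , ¬l)
...   | o , ¬lC = ⊥-elim (¬lC (owned⇒locked o))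

-- Safety

SafeSplit : ℕ → Cmd → Store → Heap → Config → Ctx → Assn → VarSet → Set₁
SafeSplit n C s ĥ ρ Γ Q A = Σ Heap λ h → Σ Heap λ hG →
  h ⊥h hG × ĥ ≐ (h ⊎h hG) × Sat⊛ s hG Γ (D ρ) × Safe n C s h ρ Γ Q A

SafeSteps : ℕ → Cmd → Store → Heap → Config → Ctx → Assn → VarSet → Set₁
SafeSteps n C s h ρ Γ Q A = ∀ hG → h ⊥h hG → Sat⊛ s hG Γ (D ρ) → ∀ C' s' ĥ ρ' →
  C , ⟨ s , h ⊎h hG , ρ ⟩ ⟶[ A , Γ ] C' , ⟨ s' , ĥ , ρ' ⟩ → SafeSplit n C' s' ĥ ρ' Γ Q A

SafeSplit-resp-≐ : ∀ n {C s} ĥ ĥ' {ρ Γ Q A} → ĥ ≐ ĥ' →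
                   SafeSplit n C s ĥ' ρ Γ Q A → SafeSplit n C s ĥ ρ Γ Q A
SafeSplit-resp-≐ n ĥ ĥ' e (h , hG , d , q , sat , safe) = h , hG , d , ≐.trans e q , sat , safe

Safe-resp-≈ρ : ∀ n {C s h ρ₁ ρ₂ Γ Q A} → ρ₁ ≈ρ ρ₂ → Safe n C s h ρ₁ Γ Q A → Safe n C s h ρ₂ Γ Q A

SafeSplit-resp-≈ρ : ∀ n {C s} ĥ {ρ₁ ρ₂ Γ Q A} → ρ₁ ≈ρ ρ₂ →
                    SafeSplit n C s ĥ ρ₁ Γ Q A → SafeSplit n C s ĥ ρ₂ Γ Q A
SafeSplit-resp-≈ρ n ĥ e (h , hG , d , q , sat , safe) =
  h , hG , d , q , Sat⊛-resp-≋ (proj₂ (proj₂ e)) sat , Safe-resp-≈ρ n e safe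

Safe-resp-≈ρ zero e safe = tt
Safe-resp-≈ρ (suc n) {C} {s} {h} {ρ₁} {ρ₂} {Γ} {Q} {A} e@(_ , l , d)
             (post , ¬abort , chng-ok , steps) =
  post , ¬abort ∘ ⟶abort-resp-≈ρ (≈ρ-sym e) ,
  (λ x c → chng-ok x c ∘ PVover-mono (All.universal (λ _ → Sum.map (proj₂ l) (proj₂ d)) Γ)) ,
  steps'
  where
  steps' : SafeSteps n C s h ρ₂ Γ Q A
  steps' hG h⊥hG sat C' s' ĥ ρ₂' (inj₁ st) with ⟶p-resp-≈ρ st (≈ρ-sym e)
  ... | ρ₁' , st₁ , e' = SafeSplit-resp-≈ρ n ĥ (≈ρ-sym e')
                           (steps hG h⊥hG (Sat⊛-resp-≋ (Setₚ.≐-sym d) sat) C' s' ĥ ρ₁' (inj₁ st₁))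
  steps' hG h⊥hG sat C' s' ĥ ρ₂' (inj₂ st) with ⟶e-resp-≈ρ st (≈ρ-sym e)
  ... | ρ₁' , st₁ , e' = SafeSplit-resp-≈ρ n ĥ (≈ρ-sym e')
                           (steps hG h⊥hG (Sat⊛-resp-≋ (Setₚ.≐-sym d) sat) C' s' ĥ ρ₁' (inj₂ st₁))

skip-safe : ∀ {Γ} → All (Precise ∘ inv) Γ → ∀ n {P A s h ρ} → FV P ⊆ A → s , h ⊨ P →
            Safe n skip s h ρ Γ P A
skip-safe precs zero    FV⊆A p = tt
skip-safe {Γ} precs (suc n) {P} {A} {s} {h} {ρ} FV⊆A p = (λ _ → p) , (λ ()) , (λ _ ()) , steps
  where
  steps : SafeSteps n skip s h ρ Γ P A
  steps hG h⊥hG sat _ s' ĥ ρ' (inj₂ st@(env agree _ _ _ _ _ _ _ _))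
    with env-local precs h hG h⊥hG sat st
  ... | hG' , h⊥hG' , ĥ≐ , sat' =
    h , hG' , h⊥hG' , ĥ≐ , sat' ,
    skip-safe precs n FV⊆A (⊨-agree P (λ x x∈ → agree x (inj₁ (FV⊆A x∈))) p)

-- The resource rule

module ResourceRule (Γ : Ctx) (r : RName) (X : VarSet) (R Q : Assn) (A : VarSet)
                    (Γ'-ok : IsResourceContext (Γ ,, r ⦅ X ⦆∶ R)) (FVQ⊆A : FV Q ⊆ A) where

  Γ' : Ctx
  Γ' = Γ ,, r ⦅ X ⦆∶ R

  precise' : All (Precise ∘ inv) Γ'
  precise' = All.tabulate (λ {e} e∈ → proj₁ (proj₂ Γ'-ok e e∈))

  precise : All (Precise ∘ inv) Γ
  precise = Allₚ.++⁻ˡ Γ precise'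

  fresh : All (λ e → name e ≢ r) Γ
  fresh = Unique-∷ʳ⁻ Γ (r ⦅ X ⦆∶ R) (proj₁ Γ'-ok)

  FVR⊆X : FV R ⊆ X
  FVR⊆X = proj₂ (proj₂ Γ'-ok _ (∈-++⁺ʳ Γ (here refl))) _

  FVQR⊆AX : FV (Q ∗ R) ⊆ (A ∪ X)
  FVQR⊆AX = Sum.map FVQ⊆A FVR⊆X

  extend-unavailable : ∀ {s hG D} → ¬ D r → Sat⊛ s hG Γ D → Sat⊛ s hG Γ' D
  extend-unavailable {hG = hG} ¬Dr sat =
    Sat⊛-∷ʳ⁺ Γ _ hG hG emptyH (λ _ → inj₂ refl) (≐.sym (⊎h-identityʳ hG emptyH (λ _ → refl)))
      sat (inj₂ (¬Dr , λ _ → refl))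

  extend-available : ∀ {s hG D} hR → hR ⊥h hG → Sat⊛ s hG Γ D → s , hR ⊨ R →
                     Sat⊛ s (hR ⊎h hG) Γ' (D ∪ ｛ r ｝)
  extend-available {hG = hG} hR hR⊥hG sat hR⊨R =
    Sat⊛-∷ʳ⁺ Γ _ (hR ⊎h hG) hG hR (⊥h-sym hR hG hR⊥hG) (⊎h-comm hR hG hR⊥hG)
      (Sat⊛-resp-D (All.map (λ e≢r → mk⇔ inj₁ [ (λ d → d) , ⊥-elim ∘ e≢r ∘ sym ]′) fresh) sat)
      (inj₁ (inj₂ refl , hR⊨R))

  restrict : ∀ {s hG D} → Sat⊛ s hG Γ D → Sat⊛ s hG Γ (D － r)
  restrict = Sat⊛-resp-D (All.map (λ e≢r → mk⇔ (_, e≢r) proj₁) fresh)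

  agree-inner : ∀ C {s s'} → AgreeOn ((A ∪ X) ∪ PVover Γ (Locked (RESOURCE r IN C))) s s' →
                AgreeOn (A ∪ PVover Γ' (Locked C)) s s'
  agree-inner C agree x (inj₁ a) = agree x (inj₁ (inj₁ a))
  agree-inner C agree x (inj₂ pv) with PVover-∷ʳ⁻ Γ _ pv
  ... | inj₁ pvΓ     = agree x (inj₂ (PVover-mono (All.map (λ e≢r l → l , e≢r) fresh) pvΓ))
  ... | inj₂ (_ , x∈X) = agree x (inj₁ (inj₂ x∈X))

  LockedCase : ℕ → Set₁
  LockedCase n = ∀ {C s h O L D} → IsConfig (cfg O L D) → ¬ r ∈ρ cfg O L D → Locked C r →
    Safe n C s h (cfg (O ∪ ｛ r ｝) L D) Γ' Q A →
    Safe n (RESOURCE r IN C) s h (cfg O L D) Γ (Q ∗ R) (A ∪ X)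

  UnlockedCase : ℕ → Set₁
  UnlockedCase n = ∀ {C s h O L D} hR → IsConfig (cfg O L D) → ¬ r ∈ρ cfg O L D →
    hR ⊥h h → s , hR ⊨ R →
    Safe n C s h (cfg O L (D ∪ ｛ r ｝)) Γ' Q A →
    Safe n (RESOURCE r IN C) s (h ⊎h hR) (cfg O L D) Γ (Q ∗ R) (A ∪ X)

  locked-safe : ∀ n → LockedCase n
  unlocked-safe : ∀ n → UnlockedCase n

  resume : ∀ m {C' s'} ĥ {ρ'} → IsConfig ρ' → r ∈ρ ρ' → ¬ L ρ' r → (O ρ' r → Locked C' r) →
           SafeSplit m C' s' ĥ ρ' Γ' Q A →
           SafeSplit m (RESOURCE r IN C') s' ĥ (ρ' ∖ρ r) Γ (Q ∗ R) (A ∪ X)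
  resume m {C'} {s'} ĥ {ρ'} c r∈ r∉L owned⇒locked (h₁ , hG₁ , h₁⊥hG₁ , ĥ≐ , sat₁ , safe₁)
    with Sat⊛-∷ʳ⁻ Γ _ hG₁ sat₁
  ... | hΓ , hr , hΓ⊥hr , hG₁≐ , satΓ , entry = continue entry
    where
    h₁⊥ : h₁ ⊥h hΓ × h₁ ⊥h hr
    h₁⊥ = ⊥h-⊎ʳ⁻ h₁ hΓ hr (⊥h-respʳ-≐ h₁ hG₁ (hΓ ⊎h hr) hG₁≐ h₁⊥hG₁)
    ĥ≐h₁⊎hΓ⊎hr : ĥ ≐ (h₁ ⊎h (hΓ ⊎h hr))
    ĥ≐h₁⊎hΓ⊎hr = ≐.trans ĥ≐ (⊎h-cong h₁ h₁ hG₁ (hΓ ⊎h hr) ≐.refl hG₁≐)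
    continue : SatEntry s' hr (r ⦅ X ⦆∶ R) (D ρ') →
               SafeSplit m (RESOURCE r IN C') s' ĥ (ρ' ∖ρ r) Γ (Q ∗ R) (A ∪ X)
    continue (inj₁ (dr , hr⊨R)) =
      h₁ ⊎h hr , hΓ , ⊥h-⊎ˡ h₁ hr hΓ (proj₁ h₁⊥) (⊥h-sym hΓ hr hΓ⊥hr) , ĥ≐h₁⊎hr⊎hΓ , restrict satΓ ,
      unlocked-safe m hr (IsConfig-∖ρ r c) (∉-∖ρ ρ' r) (⊥h-sym h₁ hr (proj₂ h₁⊥)) hr⊨R
        (Safe-resp-≈ρ m (－-≋ (λ or → proj₁ (proj₂ (c r)) (or , dr)) , －-≋ r∉L , －-∪-≋ dr) safe₁)
      where
      open ≐-Reasoning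
      ĥ≐h₁⊎hr⊎hΓ : ĥ ≐ ((h₁ ⊎h hr) ⊎h hΓ)
      ĥ≐h₁⊎hr⊎hΓ = begin
        at ĥ                   ≈⟨ ĥ≐h₁⊎hΓ⊎hr ⟩
        at (h₁ ⊎h (hΓ ⊎h hr))  ≈⟨ ⊎h-cong h₁ h₁ (hΓ ⊎h hr) (hr ⊎h hΓ) ≐.refl (⊎h-comm hΓ hr hΓ⊥hr) ⟩
        at (h₁ ⊎h (hr ⊎h hΓ))  ≈⟨ ⊎h-assoc h₁ hr hΓ ⟨
        at ((h₁ ⊎h hr) ⊎h hΓ)  ∎
    continue (inj₂ (¬dr , hr-empty)) =
      h₁ , hΓ , proj₁ h₁⊥ ,
      ≐.trans ĥ≐h₁⊎hΓ⊎hr (⊎h-cong h₁ h₁ (hΓ ⊎h hr) hΓ ≐.refl (⊎h-identityʳ hΓ hr hr-empty)) ,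
      restrict satΓ ,
      locked-safe m (IsConfig-∖ρ r c) (∉-∖ρ ρ' r) (owned⇒locked or)
        (Safe-resp-≈ρ m (－-∪-≋ or , －-≋ r∉L , －-≋ ¬dr) safe₁)
      where
      or : O ρ' r
      or = [ (λ o → o) , [ ⊥-elim ∘ r∉L , ⊥-elim ∘ ¬dr ]′ ]′ r∈

  locked-steps : ∀ m {C s h O L D} → IsConfig (cfg O L D) → ¬ r ∈ρ cfg O L D → Locked C r →
    SafeSteps m C s h (cfg (O ∪ ｛ r ｝) L D) Γ' Q A →
    SafeSteps m (RESOURCE r IN C) s h (cfg O L D) Γ (Q ∗ R) (A ∪ X)
  locked-steps m c r∉ lr steps hG h⊥hG sat _ _ _ _ (inj₁ (R0 _)) = ⊥-elim lr
  locked-steps m c r∉ lr steps hG h⊥hG sat _ _ _ _ (inj₁ (R2 _ ¬lr _)) = ⊥-elim (¬lr lr)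
  locked-steps m c r∉ lr steps hG h⊥hG sat _ s' ĥ _ (inj₁ (R1 {C' = C'} {ρ' = ρ'} _ _ st)) =
    resume m ĥ (⟶p-IsConfig st (IsConfig-∪O r c (r∉ ∘ inj₂)))
      (Equivalence.to (⟶p-names st) (inj₁ (inj₂ refl)))
      (r∉ ∘ inj₂ ∘ inj₁ ∘ ⟶p-L⊆ st)
      (⟶p-owned⇒locked st (λ _ → lr))
      (steps hG h⊥hG (extend-unavailable (r∉ ∘ inj₂ ∘ inj₂) sat) C' s' ĥ ρ' (inj₁ st))
  locked-steps m {C} {s} {h} {O} {L} {D} c r∉ lr steps hG h⊥hG sat _ s' ĥ _
               (inj₂ st@(env {L' = L'} {D'} agree LD⇔ c' _ _ _ _ _ _))
    with env-local precise h hG h⊥hG sat st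
  ... | hG' , h⊥hG' , ĥ≐ , sat' =
    settle (steps hG h⊥hG sat₊ C s' (h ⊎h hG') _ (inj₂ inner))
    where
    r∉' : ¬ r ∈ρ cfg O L' D'
    r∉' = ∉ρ-resp-⇔ O r r∉ LD⇔
    sat₊ : Sat⊛ s hG Γ' D
    sat₊ = extend-unavailable (r∉ ∘ inj₂ ∘ inj₂) sat
    sat'₊ : Sat⊛ s' hG' Γ' D'
    sat'₊ = extend-unavailable (r∉' ∘ inj₂ ∘ inj₂) sat'
    inner : C , ⟨ s , h ⊎h hG , cfg (O ∪ ｛ r ｝) L D ⟩ ⟶e[ A , Γ' ]
            C , ⟨ s' , h ⊎h hG' , cfg (O ∪ ｛ r ｝) L' D' ⟩
    inner = env {h = h} {hG} {hG'} (agree-inner C agree) LD⇔ (IsConfig-∪O r c' (r∉' ∘ inj₂))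
      h⊥hG ≐.refl sat₊ h⊥hG' ≐.refl sat'₊
    settle : SafeSplit m C s' (h ⊎h hG') (cfg (O ∪ ｛ r ｝) L' D') Γ' Q A →
             SafeSplit m (RESOURCE r IN C) s' ĥ (cfg O L' D') Γ (Q ∗ R) (A ∪ X)
    settle (h₁ , hG₁ , h₁⊥hG₁ , ≐h₁⊎hG₁ , sat₁ , safe₁) =
      h₁ , hG' , proj₁ reframed , proj₂ reframed , sat' , locked-safe m c' r∉' lr safe₁
      where
      h₁≐h : h₁ ≐ h
      h₁≐h = Sat⊛-frame-unique precise' h₁ hG₁ h hG' h₁⊥hG₁ h⊥hG' (≐.sym ≐h₁⊎hG₁) sat₁ sat'₊
      reframed : h₁ ⊥h hG' × ĥ ≐ (h₁ ⊎h hG')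
      reframed = ⊎h-substˡ ĥ h h₁ hG' (≐.sym h₁≐h) h⊥hG' ĥ≐

  unlocked-steps : ∀ m {C s h O L D} hR → IsConfig (cfg O L D) → ¬ r ∈ρ cfg O L D → ¬ Locked C r →
    hR ⊥h h → s , hR ⊨ R → (C ≡ skip → s , h ⊨ Q) →
    SafeSteps m C s h (cfg O L (D ∪ ｛ r ｝)) Γ' Q A →
    SafeSteps m (RESOURCE r IN C) s (h ⊎h hR) (cfg O L D) Γ (Q ∗ R) (A ∪ X)
  unlocked-steps m {h = h} hR c r∉ ¬lr hR⊥h hR⊨R post steps hG hhR⊥hG sat _ _ _ _ (inj₁ (R0 _)) =
    h ⊎h hR , hG , hhR⊥hG , ≐.refl , sat ,
    skip-safe precise m FVQR⊆AX (h , hR , ⊥h-sym hR h hR⊥h , ≐.refl , post refl , hR⊨R)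
  unlocked-steps m hR c r∉ ¬lr hR⊥h hR⊨R post steps hG hhR⊥hG sat _ _ _ _ (inj₁ (R1 _ lr _)) =
    ⊥-elim (¬lr lr)
  unlocked-steps m {h = h} hR c r∉ ¬lr hR⊥h hR⊨R post steps hG hhR⊥hG sat _ s' ĥ _
                 (inj₁ (R2 {C' = C'} {ρ' = ρ'} _ _ st))
    with ⟶p-resp-≐ st (h ⊎h (hR ⊎h hG)) (⊎h-assoc h hR hG)
  ... | ĥ' , st' , ĥ≐ĥ' =
    resume m ĥ (⟶p-IsConfig st' (IsConfig-∪D r c (r∉ ∘ [ inj₁ , inj₂ ∘ inj₁ ]′)))
      (Equivalence.to (⟶p-names st') (inj₂ (inj₂ (inj₂ refl))))
      (r∉ ∘ inj₂ ∘ inj₁ ∘ ⟶p-L⊆ st')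
      (⟶p-owned⇒locked st' (⊥-elim ∘ r∉ ∘ inj₁))
      (SafeSplit-resp-≐ m ĥ ĥ' ĥ≐ĥ'
        (steps (hR ⊎h hG) (proj₁ before) (extend-available hR (proj₂ before) sat hR⊨R)
          C' s' ĥ' ρ' (inj₁ st')))
    where
    before : h ⊥h (hR ⊎h hG) × hR ⊥h hG
    before = ⊥h-assoc h hR hG (⊥h-sym hR h hR⊥h) hhR⊥hG
  unlocked-steps m {C} {s} {h} {O} {L} {D} hR c r∉ ¬lr hR⊥h hR⊨R post steps hG hhR⊥hG sat _ s' ĥ _
                 (inj₂ st@(env {L' = L'} {D'} agree LD⇔ c' _ _ _ _ _ _))
    with env-local precise (h ⊎h hR) hG hhR⊥hG sat st
  ... | hG' , hhR⊥hG' , ĥ≐ , sat' =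
    settle (steps (hR ⊎h hG) (proj₁ before) sat₊ C s' (h ⊎h (hR ⊎h hG')) _ (inj₂ inner))
    where
    before : h ⊥h (hR ⊎h hG) × hR ⊥h hG
    before = ⊥h-assoc h hR hG (⊥h-sym hR h hR⊥h) hhR⊥hG
    after : h ⊥h (hR ⊎h hG') × hR ⊥h hG'
    after = ⊥h-assoc h hR hG' (⊥h-sym hR h hR⊥h) hhR⊥hG'
    r∉' : ¬ r ∈ρ cfg O L' D'
    r∉' = ∉ρ-resp-⇔ O r r∉ LD⇔
    sat₊ : Sat⊛ s (hR ⊎h hG) Γ' (D ∪ ｛ r ｝)
    sat₊ = extend-available hR (proj₂ before) sat hR⊨R
    hR⊨R' : s' , hR ⊨ R
    hR⊨R' = ⊨-agree R (λ x x∈ → agree x (inj₁ (inj₂ (FVR⊆X x∈)))) hR⊨R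
    sat'₊ : Sat⊛ s' (hR ⊎h hG') Γ' (D' ∪ ｛ r ｝)
    sat'₊ = extend-available hR (proj₂ after) sat' hR⊨R'
    inner : C , ⟨ s , h ⊎h (hR ⊎h hG) , cfg O L (D ∪ ｛ r ｝) ⟩ ⟶e[ A , Γ' ]
            C , ⟨ s' , h ⊎h (hR ⊎h hG') , cfg O L' (D' ∪ ｛ r ｝) ⟩
    inner = env {h = h} {hR ⊎h hG} {hR ⊎h hG'} (agree-inner C agree) (λ x → ⊎-extendʳ-⇔ (LD⇔ x))
      (IsConfig-∪D r c' (r∉' ∘ [ inj₁ , inj₂ ∘ inj₁ ]′))
      (proj₁ before) ≐.refl sat₊ (proj₁ after) ≐.refl sat'₊
    settle : SafeSplit m C s' (h ⊎h (hR ⊎h hG')) (cfg O L' (D' ∪ ｛ r ｝)) Γ' Q A →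
             SafeSplit m (RESOURCE r IN C) s' ĥ (cfg O L' D') Γ (Q ∗ R) (A ∪ X)
    settle (h₁ , hG₁ , h₁⊥hG₁ , ≐h₁⊎hG₁ , sat₁ , safe₁) =
      h₁ ⊎h hR , hG' , proj₁ reframed , proj₂ reframed , sat' ,
      unlocked-safe m hR c' r∉' (⊥h-respʳ-≐ hR h h₁ (≐.sym h₁≐h) hR⊥h) hR⊨R' safe₁
      where
      h₁≐h : h₁ ≐ h
      h₁≐h = Sat⊛-frame-unique precise' h₁ hG₁ h (hR ⊎h hG') h₁⊥hG₁ (proj₁ after)
               (≐.sym ≐h₁⊎hG₁) sat₁ sat'₊
      reframed : (h₁ ⊎h hR) ⊥h hG' × ĥ ≐ ((h₁ ⊎h hR) ⊎h hG')
      reframed = ⊎h-substˡ ĥ (h ⊎h hR) (h₁ ⊎h hR) hG'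
                   (⊎h-cong h h₁ hR hR (≐.sym h₁≐h) ≐.refl) hhR⊥hG' ĥ≐

  locked-safe zero _ _ _ _ = tt
  locked-safe (suc m) {C} {s} {h} {O} {L} {D} c r∉ lr (_ , ¬abort , chng-ok , steps) =
    (λ ()) , aborts , (λ x x∈chng → chng-ok x x∈chng ∘ PVover-++⁺ˡ Γ) , locked-steps m c r∉ lr steps
    where
    aborts : ¬ ((RESOURCE r IN C) , ⟨ s , h , cfg O L D ⟩ ⟶abort)
    aborts (RA r∈)        = r∉ r∈
    aborts (RA1 _ _ ab)   = ¬abort ab
    aborts (RA2 _ ¬lr _)  = ¬lr lr

  unlocked-safe zero _ _ _ _ _ _ = tt
  unlocked-safe (suc m) {C} {s} {h} {O} {L} {D} hR c r∉ hR⊥h hR⊨R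
                (post , ¬abort , chng-ok , steps) =
    (λ ()) , aborts , (λ x x∈chng → chng-ok x x∈chng ∘ PV⊆) ,
    unlocked-steps m hR c r∉ ¬lr hR⊥h hR⊨R post steps
    where
    PV⊆ : PVover Γ (L ∪ D) ⊆ PVover Γ' (L ∪ (D ∪ ｛ r ｝))
    PV⊆ = PVover-++⁺ˡ Γ ∘ PVover-mono (All.universal (λ _ → Sum.map₂ inj₁) Γ)
    ¬lr : ¬ Locked C r
    ¬lr lr = locked⇒owned C ¬abort lr (λ or → r∉ (inj₁ or))
    aborts : ¬ ((RESOURCE r IN C) , ⟨ s , h ⊎h hR , cfg O L D ⟩ ⟶abort)
    aborts (RA r∈)        = r∉ r∈
    aborts (RA1 _ lr _)   = ¬lr lr
    aborts (RA2 _ _ ab)   = ¬abort (⟶abort-⊑ h (⊑-⊎ˡ h hR) ab)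

proposition15 :
    ∀ (n : ℕ) (C : Cmd) (s : Store) (h : Heap) (Γ : Ctx) (O L D : RSet)
      (Q R : Assn) (A X : VarSet) (r : RName) →
    Reachable C →
    IsResourceContext Γ →
    IsConfig (cfg O L D) →
    ¬ (r ∈ρ cfg O L D) →
    IsResourceContext (Γ ,, r ⦅ X ⦆∶ R) →
    FV Q ⊆ A →
    ((Locked C r →
        Safe n C s h (cfg (O ∪ ｛ r ｝) L D) (Γ ,, r ⦅ X ⦆∶ R) Q A →
        Safe n (RESOURCE r IN C) s h (cfg O L D) Γ (Q ∗ R) (A ∪ X))
     ×
     (¬ Locked C r →
        ∀ (hR : Heap) → hR ⊥h h → s , hR ⊨ R →
        Safe n C s h (cfg O L (D ∪ ｛ r ｝)) (Γ ,, r ⦅ X ⦆∶ R) Q A →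
        Safe n (RESOURCE r IN C) s (h ⊎h hR) (cfg O L D) Γ (Q ∗ R) (A ∪ X)))
proposition15 n C s h Γ O L D Q R A X r _ _ c r∉ Γ'-ok FVQ⊆A =
  locked-safe n c r∉ , λ _ hR hR⊥h hR⊨R → unlocked-safe n hR c r∉ hR⊥h hR⊨R
  where open ResourceRule Γ r X R Q A Γ'-ok FVQ⊆A
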